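{- Let $p$ be a prime and $b\ge1$ an integer. Then the zero-divisor graph $\varGamma(\mathbb{Z}_p[x]/\langle x^{b}\rangle)$ is distance Laplacian integral, i.e. every eigenvalue of its distance Laplacian matrix is an integer.
   Context: The zero-divisor graph $\varGamma(R)$ of a commutative ring $R$ has vertex set the nonzero zero-divisors of $R$, distinct $x,y$ adjacent iff $xy=0$; for $R=\mathbb{Z}_p[x]/\langle x^b\rangle$ this graph is connected whenever it is nonempty. For a connected graph $G$ with vertices $v_1,\dots,v_n$, let $D_{\mathrm{dist}}(G)$ be the matrix of graph distances $d_G(v_i,v_j)$ and $\mathrm{Tr}(G)=\mathrm{diag}(t(v_1),\dots,t(v_n))$ with $t(v_i)=\sum_j d_G(v_i,v_j)$; the distance Laplacian is $\mathrm{Tr}(G)-D_{\mathrm{dist}}(G)$. -}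

module Defs where

open import Data.Bool using (Bool; true; false; _∧_; _∨_; not; if_then_else_)
open import Data.Nat as ℕ using (ℕ; zero; suc; _∸_)
open import Data.Nat.Divisibility using (_∣?_)
open import Data.Fin as Fin using (Fin; toℕ; punchIn)
open import Data.Vec as Vec using (Vec; toList)
open import Data.List as List using (List; []; _∷_; allFin; filter; length; map; concatMap; upTo)
open import Data.Bool.ListAction using (any; all)
open import Data.Integer as ℤ using (ℤ; +_; -_)
open import Relation.Nullary using (does; ¬_)
open import Relation.Nullary.Decidable using (⌊_⌋)
open import Relation.Unary using (Decidable)

-- The ring Z_p[x]/<x^b>: an element is its coefficient vector
-- (a_0, ..., a_{b-1}) with a_i ∈ Z_p (represented as Fin p).

Elem : ℕ → ℕ → Set
Elem p b = Vec (Fin p) b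

allElems : (p b : ℕ) → List (Elem p b)
allElems p zero    = Vec.[] ∷ []
allElems p (suc b) = concatMap (λ c → map (c Vec.∷_) (allElems p b)) (allFin p)

-- k-th coefficient as a natural number (0 beyond the length)
nth : List ℕ → ℕ → ℕ
nth []       _       = 0
nth (x ∷ _)  zero    = x
nth (_ ∷ xs) (suc k) = nth xs k

coef : {p b : ℕ} → Elem p b → ℕ → ℕ
coef a k = nth (map toℕ (toList a)) k

sumℕ : List ℕ → ℕ
sumℕ = List.foldr ℕ._+_ 0

-- k-th coefficient (as an integer in ℕ, before reduction mod p) of the
-- polynomial product a·c
prodCoef : {p b : ℕ} → Elem p b → Elem p b → ℕ → ℕ
prodCoef a c k = sumℕ (map (λ i → coef a i ℕ.* coef c (k ∸ i)) (upTo (suc k)))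

isZeroᵇ : {p b : ℕ} → Elem p b → Bool
isZeroᵇ {b = b} a = all (λ k → ⌊ coef a k ℕ.≟ 0 ⌋) (upTo b)

-- a·c = 0 in Z_p[x]/<x^b>: every coefficient of degree < b of the
-- product is divisible by p
mulZeroᵇ : {p b : ℕ} → Elem p b → Elem p b → Bool
mulZeroᵇ {p} {b} a c = all (λ k → ⌊ p ∣? prodCoef a c k ⌋) (upTo b)

isNZZDᵇ : {p b : ℕ} → Elem p b → Bool
isNZZDᵇ {p} {b} a = not (isZeroᵇ a) ∧ any (λ c → not (isZeroᵇ c) ∧ mulZeroᵇ a c) (allElems p b)

vertexList : (p b : ℕ) → List (Elem p b)
vertexList p b = filter (λ a → Data.Bool._≟_ (isNZZDᵇ a) true) (allElems p b)
  where import Data.Bool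

nV : ℕ → ℕ → ℕ
nV p b = length (vertexList p b)

vertex : (p b : ℕ) → Fin (nV p b) → Elem p b
vertex p b i = List.lookup (vertexList p b) i

module Graph (n : ℕ) (adj : Fin n → Fin n → Bool) where

  reach : ℕ → Fin n → Fin n → Bool
  reach zero    i j = ⌊ i Fin.≟ j ⌋
  reach (suc k) i j = reach k i j ∨ any (λ w → reach k i w ∧ adj w j) (allFin n)

  distAux : ℕ → ℕ → Fin n → Fin n → ℕ
  distAux zero       k i j = k
  distAux (suc fuel) k i j = if reach k i j then k else distAux fuel (suc k) i j

  -- graph distance d(i,j) (correct for connected graphs, where d ≤ n-1)
  dist : Fin n → Fin n → ℕ
  dist i j = distAux n 0 i j

  trans : Fin n → ℕ
  trans i = sumℕ (map (dist i) (allFin n))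

  distLap : Fin n → Fin n → ℤ
  distLap i j = if ⌊ i Fin.≟ j ⌋ then + trans i ℤ.- + dist i j else - (+ dist i j)

-- Polynomials over ℤ: coefficient lists, lowest degree first.

Poly : Set
Poly = List ℤ

coeffP : Poly → ℕ → ℤ
coeffP []       _       = + 0
coeffP (x ∷ _)  zero    = x
coeffP (_ ∷ xs) (suc k) = coeffP xs k

_+P_ : Poly → Poly → Poly
[]       +P q        = q
(x ∷ xs) +P []       = x ∷ xs
(x ∷ xs) +P (y ∷ ys) = (x ℤ.+ y) ∷ (xs +P ys)

scaleP : ℤ → Poly → Poly
scaleP c = map (c ℤ.*_)

_*P_ : Poly → Poly → Poly
[]       *P q = []
(x ∷ xs) *P q = scaleP x q +P (+ 0 ∷ (xs *P q))

negP : Poly → Poly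
negP = scaleP (- + 1)

sumP : List Poly → Poly
sumP = List.foldr _+P_ []

prodP : List Poly → Poly
prodP = List.foldr _*P_ (+ 1 ∷ [])

_≈P_ : Poly → Poly → Set
p ≈P q = ∀ k → coeffP p k ≡ coeffP q k
  where open import Relation.Binary.PropositionalEquality using (_≡_)

det : (n : ℕ) → (Fin n → Fin n → Poly) → Poly
det zero    M = + 1 ∷ []
det (suc n) M = sumP (map term (allFin (suc n)))
  where
  sign : ℕ → Poly → Poly
  sign zero          q = q
  sign (suc zero)    q = negP q
  sign (suc (suc k)) q = sign k q
  term : Fin (suc n) → Poly
  term j = sign (toℕ j) (M Fin.zero j *P det n (λ r c → M (Fin.suc r) (punchIn j c)))

charPoly : (n : ℕ) → (Fin n → Fin n → ℤ) → Poly
charPoly n A = det n (λ i j → if ⌊ i Fin.≟ j ⌋ then (- A i j) ∷ + 1 ∷ [] else (- A i j) ∷ [])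

-- every eigenvalue (root of the characteristic polynomial over ℂ, with
-- multiplicity) is an integer: charPoly = ∏ (x - λᵢ) with λᵢ ∈ ℤ
open import Data.Product using (∃)
IntegralSpectrum : (n : ℕ) → (Fin n → Fin n → ℤ) → Set
IntegralSpectrum n A = ∃ λ (ls : List ℤ) → charPoly n A ≈P prodP (map (λ l → (- l) ∷ + 1 ∷ []) ls)

adjΓ : (p b : ℕ) → Fin (nV p b) → Fin (nV p b) → Bool
adjΓ p b i j = not ⌊ i Fin.≟ j ⌋ ∧ mulZeroᵇ (vertex p b i) (vertex p b j)

distLapΓ : (p b : ℕ) → Fin (nV p b) → Fin (nV p b) → ℤ
distLapΓ p b = Graph.distLap (nV p b) (adjΓ p b)

DistanceLaplacianIntegral : (p b : ℕ) → Set
DistanceLaplacianIntegral p b = IntegralSpectrum (nV p b) (distLapΓ p b)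

-- A nonzero zero-divisor a of ℤ_p[x]/⟨x^b⟩ has x-adic valuation v(a) ∈ [1, b), and
-- a·c = 0 iff v(a) + v(c) ≥ b. So Γ is the threshold graph with weights v and
-- threshold b; x^(b-1) is adjacent to every other vertex, so all distances are 1 or 2
-- and x I − (distance Laplacian) = x I + 2J − 2n I + L, with L the Laplacian of Γ.
-- Matrices x I + cJ + βI + L of a threshold graph have constant row sums, so their
-- determinant is (x + β + cn) times the determinant of a matrix of the same shape on
-- the graph minus u, for any vertex u adjacent to all or to none of the others; a
-- vertex of maximal or minimal weight is one. By induction on n the characteristic
-- polynomial is a product of integer linear factors.

module Submission where

open import Defs using (DistanceLaplacianIntegral)
open import Data.Nat using (ℕ; _≥_; suc; s≤s; z≤n)
open import Data.Nat.Primality using (Prime)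
open import Algebra.Bundles using (CommutativeRing)

module Punch where

  open import Data.Nat as ℕ using (ℕ; zero; suc)
  import Data.Nat.Properties as ℕ
  open import Data.Fin using (Fin; zero; suc; toℕ; punchIn; inject₁)
  open import Data.Fin.Properties using (suc-injective; toℕ-inject₁)
  open import Data.Product using (Σ; _,_; _×_)
  open import Data.Empty using (⊥-elim)
  open import Function using (_∘_)
  open import Relation.Binary.PropositionalEquality

  inject₁≢suc : ∀ {n} (i : Fin n) → inject₁ i ≢ suc i
  inject₁≢suc i eq = ℕ.1+n≢n (sym (trans (sym (toℕ-inject₁ i)) (cong toℕ eq)))

  punchIn-inject₁-self : ∀ {n} (i : Fin n) → punchIn (inject₁ i) i ≡ suc i
  punchIn-inject₁-self zero    = refl
  punchIn-inject₁-self (suc i) = cong suc (punchIn-inject₁-self i)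

  punchIn-suc-self : ∀ {n} (i : Fin n) → punchIn (suc i) i ≡ inject₁ i
  punchIn-suc-self zero    = refl
  punchIn-suc-self (suc i) = cong suc (punchIn-suc-self i)

  punchIn-inject₁≡punchIn-suc : ∀ {n} (i c : Fin n) → c ≢ i → punchIn (inject₁ i) c ≡ punchIn (suc i) c
  punchIn-inject₁≡punchIn-suc zero    zero    c≢i = ⊥-elim (c≢i refl)
  punchIn-inject₁≡punchIn-suc zero    (suc c) c≢i = refl
  punchIn-inject₁≡punchIn-suc (suc i) zero    c≢i = refl
  punchIn-inject₁≡punchIn-suc (suc i) (suc c) c≢i = cong suc (punchIn-inject₁≡punchIn-suc i c (c≢i ∘ cong suc))

  punchIn-adjacent : ∀ {n} (i : Fin (suc n)) (j : Fin (suc (suc n))) → j ≢ inject₁ i → j ≢ suc i →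
                     Σ (Fin n) λ i′ → punchIn j (inject₁ i′) ≡ inject₁ i × punchIn j (suc i′) ≡ suc i
  punchIn-adjacent {n}     zero    zero          j≢i _   = ⊥-elim (j≢i refl)
  punchIn-adjacent {n}     zero    (suc zero)    _   j≢i = ⊥-elim (j≢i refl)
  punchIn-adjacent {suc n} zero    (suc (suc j)) _   _   = zero , refl , refl
  punchIn-adjacent {suc n} (suc i) zero          _   _   = i , refl , refl
  punchIn-adjacent {suc n} (suc i) (suc j) j≢i j≢1+i with punchIn-adjacent i j (j≢i ∘ cong suc) (j≢1+i ∘ cong suc)
  ... | i′ , eq₁ , eq₂ = suc i′ , cong suc eq₁ , cong suc eq₂

  -- If v′ is the position of v once j′ = punchIn v j is deleted, the two ways of
  -- deleting both v and j′ agree.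
  punchIn-punchIn : ∀ {m} (v : Fin (suc (suc m))) (j v′ : Fin (suc m)) (c : Fin m) →
                    punchIn (punchIn v j) v′ ≡ v → punchIn (punchIn v j) (punchIn v′ c) ≡ punchIn v (punchIn j c)
  punchIn-punchIn zero    j       zero     c       eq = refl
  punchIn-punchIn (suc v) zero    v′       c       eq with suc-injective eq
  ... | refl = refl
  punchIn-punchIn {suc m} (suc v) (suc j) (suc v′) zero    eq = refl
  punchIn-punchIn {suc m} (suc v) (suc j) (suc v′) (suc c) eq = cong suc (punchIn-punchIn v j v′ c (suc-injective eq))

  distinct⇒2≤ : ∀ {n} {i j : Fin n} → i ≢ j → 2 ℕ.≤ n
  distinct⇒2≤ {suc zero}    {zero} {zero} i≢j = ⊥-elim (i≢j refl)
  distinct⇒2≤ {suc (suc n)} _                 = ℕ.s≤s (ℕ.s≤s ℕ.z≤n)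

module Polynomials where

  open import Defs using (Poly; coeffP; _+P_; scaleP; _*P_; negP; _≈P_)
  open import Data.Nat using (ℕ; zero; suc)
  open import Data.Integer using (ℤ; +_; -_; _+_; _*_)
  open import Data.Integer.Properties
    using (+-identityˡ; +-identityʳ; +-assoc; +-comm; *-zeroʳ; *-identityˡ; *-assoc; *-comm; *-distribʳ-+; *-distribˡ-+)
  open import Data.Integer.Tactic.RingSolver using (solve-∀)
  open import Data.List using ([]; _∷_)
  open import Data.Product using (_,_)
  open import Function using (_∘_)
  open import Level using (0ℓ)
  open import Algebra.Bundles using (CommutativeRing)
  open import Relation.Binary.PropositionalEquality
  open ≡-Reasoning

  coeffP-+P : ∀ p q k → coeffP (p +P q) k ≡ coeffP p k + coeffP q k
  coeffP-+P []      q       k       = sym (+-identityˡ _)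
  coeffP-+P (x ∷ p) []      k       = sym (+-identityʳ _)
  coeffP-+P (x ∷ p) (y ∷ q) zero    = refl
  coeffP-+P (x ∷ p) (y ∷ q) (suc k) = coeffP-+P p q k

  coeffP-scaleP : ∀ c p k → coeffP (scaleP c p) k ≡ c * coeffP p k
  coeffP-scaleP c []      k       = sym (*-zeroʳ c)
  coeffP-scaleP c (x ∷ p) zero    = refl
  coeffP-scaleP c (x ∷ p) (suc k) = coeffP-scaleP c p k

  -- conv f g k = Σ_{i ≤ k} f i * g (k - i), peeling off the term i = 0.
  conv : (ℕ → ℤ) → (ℕ → ℤ) → ℕ → ℤ
  conv f g zero    = f 0 * g 0
  conv f g (suc k) = f 0 * g (suc k) + conv (f ∘ suc) g k

  conv-cong : ∀ {f f′ g g′} → f ≗ f′ → g ≗ g′ → conv f g ≗ conv f′ g′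
  conv-cong f≗f′ g≗g′ zero    = cong₂ _*_ (f≗f′ 0) (g≗g′ 0)
  conv-cong f≗f′ g≗g′ (suc k) = cong₂ _+_ (cong₂ _*_ (f≗f′ 0) (g≗g′ (suc k))) (conv-cong (f≗f′ ∘ suc) g≗g′ k)

  conv-zeroˡ : ∀ {f} g → (∀ i → f i ≡ + 0) → ∀ k → conv f g k ≡ + 0
  conv-zeroˡ g f≡0 zero    rewrite f≡0 0 = refl
  conv-zeroˡ g f≡0 (suc k) rewrite f≡0 0 | conv-zeroˡ g (f≡0 ∘ suc) k = refl

  conv-identityˡ : ∀ g k → conv (coeffP (+ 1 ∷ [])) g k ≡ g k
  conv-identityˡ g zero    = *-identityˡ (g 0)
  conv-identityˡ g (suc k) rewrite conv-zeroˡ g (λ _ → refl) k = trans (+-identityʳ _) (*-identityˡ _)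

  conv-distribʳ : ∀ f f′ g k → conv (λ i → f i + f′ i) g k ≡ conv f g k + conv f′ g k
  conv-distribʳ f f′ g zero    = *-distribʳ-+ (g 0) (f 0) (f′ 0)
  conv-distribʳ f f′ g (suc k)
    rewrite conv-distribʳ (f ∘ suc) (f′ ∘ suc) g k | *-distribʳ-+ (g (suc k)) (f 0) (f′ 0)
    = interchange (f 0 * g (suc k)) (f′ 0 * g (suc k)) (conv (f ∘ suc) g k) (conv (f′ ∘ suc) g k)
    where
    interchange : ∀ a b c d → a + b + (c + d) ≡ a + c + (b + d)
    interchange = solve-∀

  conv-scaleˡ : ∀ c f g k → conv (λ i → c * f i) g k ≡ c * conv f g k
  conv-scaleˡ c f g zero    = *-assoc c (f 0) (g 0)
  conv-scaleˡ c f g (suc k) rewrite conv-scaleˡ c (f ∘ suc) g k | *-assoc c (f 0) (g (suc k)) =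
    sym (*-distribˡ-+ c _ _)

  conv-sucʳ : ∀ f g k → conv f g (suc k) ≡ conv f (g ∘ suc) k + f (suc k) * g 0
  conv-sucʳ f g zero    = refl
  conv-sucʳ f g (suc k) rewrite conv-sucʳ (f ∘ suc) g k =
    sym (+-assoc (f 0 * g (suc (suc k))) (conv (f ∘ suc) (g ∘ suc) k) (f (suc (suc k)) * g 0))

  conv-comm : ∀ f g k → conv f g k ≡ conv g f k
  conv-comm f g zero    = *-comm (f 0) (g 0)
  conv-comm f g (suc k) rewrite conv-sucʳ g f k | conv-comm (f ∘ suc) g k
    | *-comm (f 0) (g (suc k)) = +-comm (g (suc k) * f 0) (conv g (f ∘ suc) k)

  conv-assoc : ∀ f g h k → conv (conv f g) h k ≡ conv f (conv g h) k
  conv-assoc f g h zero    = *-assoc (f 0) (g 0) (h 0)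
  conv-assoc f g h (suc k) = begin
    conv f g 0 * h (suc k) + conv (λ i → f 0 * g (suc i) + conv (f ∘ suc) g i) h k
      ≡⟨ cong (λ z → conv f g 0 * h (suc k) + z) (conv-distribʳ (λ i → f 0 * g (suc i)) (conv (f ∘ suc) g) h k) ⟩
    conv f g 0 * h (suc k) + (conv (λ i → f 0 * g (suc i)) h k + conv (conv (f ∘ suc) g) h k)
      ≡⟨ cong₂ (λ a b → conv f g 0 * h (suc k) + (a + b)) (conv-scaleˡ (f 0) (g ∘ suc) h k) (conv-assoc (f ∘ suc) g h k) ⟩
    f 0 * g 0 * h (suc k) + (f 0 * conv (g ∘ suc) h k + conv (f ∘ suc) (conv g h) k)
      ≡⟨ regroup (f 0) (g 0) (h (suc k)) _ _ ⟩
    f 0 * (g 0 * h (suc k) + conv (g ∘ suc) h k) + conv (f ∘ suc) (conv g h) k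
      ∎
    where
    regroup : ∀ a b c d e → a * b * c + (a * d + e) ≡ a * (b * c + d) + e
    regroup = solve-∀

  coeffP-*P : ∀ p q k → coeffP (p *P q) k ≡ conv (coeffP p) (coeffP q) k
  coeffP-*P []      q k       = sym (conv-zeroˡ (coeffP q) (λ _ → refl) k)
  coeffP-*P (x ∷ p) q zero    rewrite coeffP-+P (scaleP x q) (+ 0 ∷ (p *P q)) 0 | coeffP-scaleP x q 0 = +-identityʳ _
  coeffP-*P (x ∷ p) q (suc k) rewrite coeffP-+P (scaleP x q) (+ 0 ∷ (p *P q)) (suc k) | coeffP-scaleP x q (suc k)
    | coeffP-*P p q k = refl

  -- A record rather than _≈P_ itself, so that p and q can be inferred from a proof.
  infix 4 _≋_
  record _≋_ (p q : Poly) : Set where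
    constructor mk≋
    field get : p ≈P q
  open _≋_ public

  private
    1P : Poly
    1P = + 1 ∷ []

    ≋-trans : ∀ {p q r} → p ≋ q → q ≋ r → p ≋ r
    ≋-trans (mk≋ p≈q) (mk≋ q≈r) = mk≋ (λ k → trans (p≈q k) (q≈r k))

    +P-cong : ∀ {p p′ q q′} → p ≋ p′ → q ≋ q′ → p +P q ≋ p′ +P q′
    +P-cong {p} {p′} {q} {q′} (mk≋ p≈p′) (mk≋ q≈q′) = mk≋ λ k → begin
      coeffP (p +P q) k             ≡⟨ coeffP-+P p q k ⟩
      coeffP p k + coeffP q k       ≡⟨ cong₂ _+_ (p≈p′ k) (q≈q′ k) ⟩
      coeffP p′ k + coeffP q′ k     ≡⟨ coeffP-+P p′ q′ k ⟨
      coeffP (p′ +P q′) k           ∎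

    *P-cong : ∀ {p p′ q q′} → p ≋ p′ → q ≋ q′ → p *P q ≋ p′ *P q′
    *P-cong {p} {p′} {q} {q′} (mk≋ p≈p′) (mk≋ q≈q′) = mk≋ λ k → begin
      coeffP (p *P q) k                 ≡⟨ coeffP-*P p q k ⟩
      conv (coeffP p) (coeffP q) k      ≡⟨ conv-cong p≈p′ q≈q′ k ⟩
      conv (coeffP p′) (coeffP q′) k    ≡⟨ coeffP-*P p′ q′ k ⟨
      coeffP (p′ *P q′) k               ∎

    negP-cong : ∀ {p q} → p ≋ q → negP p ≋ negP q
    negP-cong {p} {q} (mk≋ p≈q) = mk≋ λ k →
      trans (coeffP-scaleP (- + 1) p k) (trans (cong (- + 1 *_) (p≈q k)) (sym (coeffP-scaleP (- + 1) q k)))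

    +P-assoc : ∀ p q r → (p +P q) +P r ≋ p +P (q +P r)
    +P-assoc p q r = mk≋ λ k → begin
      coeffP ((p +P q) +P r) k                  ≡⟨ coeffP-+P (p +P q) r k ⟩
      coeffP (p +P q) k + coeffP r k            ≡⟨ cong (_+ coeffP r k) (coeffP-+P p q k) ⟩
      coeffP p k + coeffP q k + coeffP r k      ≡⟨ +-assoc (coeffP p k) (coeffP q k) (coeffP r k) ⟩
      coeffP p k + (coeffP q k + coeffP r k)    ≡⟨ cong (λ z → coeffP p k + z) (coeffP-+P q r k) ⟨
      coeffP p k + coeffP (q +P r) k            ≡⟨ coeffP-+P p (q +P r) k ⟨
      coeffP (p +P (q +P r)) k                  ∎

    +P-comm : ∀ p q → p +P q ≋ q +P p
    +P-comm p q = mk≋ λ k → begin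
      coeffP (p +P q) k          ≡⟨ coeffP-+P p q k ⟩
      coeffP p k + coeffP q k    ≡⟨ +-comm (coeffP p k) (coeffP q k) ⟩
      coeffP q k + coeffP p k    ≡⟨ coeffP-+P q p k ⟨
      coeffP (q +P p) k          ∎

    +P-identityʳ : ∀ p → p +P [] ≋ p
    +P-identityʳ p = mk≋ λ k → trans (coeffP-+P p [] k) (+-identityʳ (coeffP p k))

    negP-inverseˡ : ∀ p → negP p +P p ≋ []
    negP-inverseˡ p = mk≋ λ k → begin
      coeffP (negP p +P p) k                ≡⟨ coeffP-+P (negP p) p k ⟩
      coeffP (negP p) k + coeffP p k        ≡⟨ cong (_+ coeffP p k) (coeffP-scaleP (- + 1) p k) ⟩
      - + 1 * coeffP p k + coeffP p k       ≡⟨ cancel (coeffP p k) ⟩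
      + 0                                   ∎
      where
      cancel : ∀ a → - + 1 * a + a ≡ + 0
      cancel = solve-∀

    *P-assoc : ∀ p q r → (p *P q) *P r ≋ p *P (q *P r)
    *P-assoc p q r = mk≋ λ k → begin
      coeffP ((p *P q) *P r) k                              ≡⟨ coeffP-*P (p *P q) r k ⟩
      conv (coeffP (p *P q)) (coeffP r) k                   ≡⟨ conv-cong (coeffP-*P p q) (λ _ → refl) k ⟩
      conv (conv (coeffP p) (coeffP q)) (coeffP r) k        ≡⟨ conv-assoc (coeffP p) (coeffP q) (coeffP r) k ⟩
      conv (coeffP p) (conv (coeffP q) (coeffP r)) k        ≡⟨ conv-cong (λ _ → refl) (coeffP-*P q r) k ⟨
      conv (coeffP p) (coeffP (q *P r)) k                   ≡⟨ coeffP-*P p (q *P r) k ⟨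
      coeffP (p *P (q *P r)) k                              ∎

    *P-comm : ∀ p q → p *P q ≋ q *P p
    *P-comm p q = mk≋ λ k → begin
      coeffP (p *P q) k                  ≡⟨ coeffP-*P p q k ⟩
      conv (coeffP p) (coeffP q) k       ≡⟨ conv-comm (coeffP p) (coeffP q) k ⟩
      conv (coeffP q) (coeffP p) k       ≡⟨ coeffP-*P q p k ⟨
      coeffP (q *P p) k                  ∎

    *P-identityˡ : ∀ p → 1P *P p ≋ p
    *P-identityˡ p = mk≋ λ k → trans (coeffP-*P 1P p k) (conv-identityˡ (coeffP p) k)

    *P-distribʳ : ∀ r p q → (p +P q) *P r ≋ (p *P r) +P (q *P r)
    *P-distribʳ r p q = mk≋ λ k → begin
      coeffP ((p +P q) *P r) k                                           ≡⟨ coeffP-*P (p +P q) r k ⟩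
      conv (coeffP (p +P q)) (coeffP r) k                                ≡⟨ conv-cong (coeffP-+P p q) (λ _ → refl) k ⟩
      conv (λ i → coeffP p i + coeffP q i) (coeffP r) k                  ≡⟨ conv-distribʳ (coeffP p) (coeffP q) (coeffP r) k ⟩
      conv (coeffP p) (coeffP r) k + conv (coeffP q) (coeffP r) k        ≡⟨ cong₂ _+_ (coeffP-*P p r k) (coeffP-*P q r k) ⟨
      coeffP (p *P r) k + coeffP (q *P r) k                              ≡⟨ coeffP-+P (p *P r) (q *P r) k ⟨
      coeffP ((p *P r) +P (q *P r)) k                                    ∎

  Poly-commutativeRing : CommutativeRing 0ℓ 0ℓ
  Poly-commutativeRing = record
    { Carrier = Poly ; _≈_ = _≋_ ; _+_ = _+P_ ; _*_ = _*P_ ; -_ = negP ; 0# = [] ; 1# = 1P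
    ; isCommutativeRing = record
      { isRing = record
        { +-isAbelianGroup = record
          { isGroup = record
            { isMonoid = record
              { isSemigroup = record
                { isMagma = record
                  { isEquivalence = record
                    { refl = mk≋ (λ _ → refl) ; sym = λ (mk≋ e) → mk≋ (sym ∘ e) ; trans = ≋-trans }
                  ; ∙-cong = +P-cong }
                ; assoc = +P-assoc }
              ; identity = (λ p → mk≋ (λ _ → refl)) , +P-identityʳ }
            ; inverse = negP-inverseˡ , (λ p → ≋-trans (+P-comm p (negP p)) (negP-inverseˡ p))
            ; ⁻¹-cong = negP-cong }
          ; comm = +P-comm }
        ; *-cong = *P-cong
        ; *-assoc = *P-assoc
        ; *-identity = *P-identityˡ , (λ p → ≋-trans (*P-comm p 1P) (*P-identityˡ p))
        ; distrib = (λ r p q → ≋-trans (*P-comm r (p +P q))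
                      (≋-trans (*P-distribʳ r p q) (+P-cong (*P-comm p r) (*P-comm q r))))
                  , *P-distribʳ }
      ; *-comm = *P-comm } }

module Determinant {c ℓ} (R : CommutativeRing c ℓ) where

  open import Data.Nat as ℕ using (ℕ; zero; suc)
  import Data.Nat.Properties as ℕ
  open import Algebra.Properties.CommutativeSemigroup ℕ.+-commutativeSemigroup using (x∙yz≈y∙xz)
  open import Data.Fin as Fin using (Fin; zero; suc; toℕ; punchIn; punchOut; inject₁)
  import Data.Fin.Properties as Fin
  open import Data.Vec.Functional using (removeAt)
  open import Data.Sum using (_⊎_; inj₁; inj₂)
  open import Data.Product using (_,_)
  open import Function using (_∘_; flip)
  open import Relation.Binary.PropositionalEquality as ≡ using (_≡_; _≢_)
  open import Relation.Nullary using (yes; no; Dec)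
  open import Relation.Binary.Definitions using (tri<; tri≈; tri>)
  open import Data.Empty using (⊥-elim)
  open Punch

  open CommutativeRing R hiding (zero)
  open import Algebra.Properties.Ring ring
    using (-‿involutive; -‿distribˡ-*; -0#≈0#; +-inverseʳ-unique; x+x≈x⇒x≈0)
  open import Algebra.Properties.Semiring.Sum semiring
    using (sum; sum-cong-≋; sum-replicate-zero; sum-remove; ∑-distrib-+; *-distribˡ-sum)
  open import Relation.Binary.Reasoning.Setoid setoid
  open import Algebra.Solver.CommutativeMonoid *-commutativeMonoid using (solve; _⊕_; _⊜_)

  Matrix : ℕ → Set c
  Matrix n = Fin n → Fin n → Carrier

  sign : ℕ → Carrier
  sign zero    = 1#
  sign (suc k) = - sign k

  minor : ∀ {n} → Fin (suc n) → Matrix (suc n) → Matrix n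
  minor j M r c = M (suc r) (punchIn j c)

  submatrix : ∀ {n} → Fin (suc n) → Fin (suc n) → Matrix (suc n) → Matrix n
  submatrix u v M r c = M (punchIn u r) (punchIn v c)

  -- The first-row cofactor expansion of Defs.det, over an arbitrary commutative ring.
  det : (n : ℕ) → Matrix n → Carrier
  det zero    M = 1#
  det (suc n) M = sum λ j → sign (toℕ j) * (M zero j * det n (minor j M))

  sum-zero : ∀ {m} {f : Fin m → Carrier} → (∀ i → f i ≈ 0#) → sum f ≈ 0#
  sum-zero {m} f≈0 = trans (sum-cong-≋ f≈0) (sum-replicate-zero m)

  sum-single : ∀ {m} (v : Fin m) (f : Fin m → Carrier) → (∀ i → i ≢ v → f i ≈ 0#) → sum f ≈ f v
  sum-single {suc m} v f f≈0 = begin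
    sum f                      ≈⟨ sum-remove f ⟩
    f v + sum (removeAt f v)   ≈⟨ +-congˡ (sum-zero (λ i → f≈0 (punchIn v i) (Fin.punchInᵢ≢i v i))) ⟩
    f v + 0#                   ≈⟨ +-identityʳ (f v) ⟩
    f v                        ∎

  sign-+ : ∀ a b → sign (a ℕ.+ b) ≈ sign a * sign b
  sign-+ zero    b = sym (*-identityˡ (sign b))
  sign-+ (suc a) b = trans (-‿cong (sign-+ a b)) (-‿distribˡ-* (sign a) (sign b))

  sign[k+k]≈1# : ∀ k → sign (k ℕ.+ k) ≈ 1#
  sign[k+k]≈1# zero    = refl
  sign[k+k]≈1# (suc k) = begin
    - sign (k ℕ.+ suc k)     ≡⟨ ≡.cong (-_ ∘ sign) (ℕ.+-suc k k) ⟩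
    - - sign (k ℕ.+ k)       ≈⟨ -‿involutive _ ⟩
    sign (k ℕ.+ k)           ≈⟨ sign[k+k]≈1# k ⟩
    1#                       ∎

  det-cong : ∀ n {M N : Matrix n} → (∀ r c → M r c ≈ N r c) → det n M ≈ det n N
  det-cong zero    M≈N = refl
  det-cong (suc n) M≈N = sum-cong-≋ λ j →
    *-congˡ {sign (toℕ j)} (*-cong (M≈N zero j) (det-cong n (λ r c → M≈N (suc r) (punchIn j c))))

  private
    *-distribˡ-linear : ∀ x a y z → x * (a * y + z) ≈ a * (x * y) + x * z
    *-distribˡ-linear x a y z = begin
      x * (a * y + z)         ≈⟨ distribˡ x (a * y) z ⟩
      x * (a * y) + x * z     ≈⟨ +-congʳ (sym (*-assoc x a y)) ⟩
      x * a * y + x * z       ≈⟨ +-congʳ (*-congʳ (*-comm x a)) ⟩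
      a * x * y + x * z       ≈⟨ +-congʳ (*-assoc a x y) ⟩
      a * (x * y) + x * z     ∎

    *-distribʳ-linear : ∀ a y z d → (a * y + z) * d ≈ a * (y * d) + z * d
    *-distribʳ-linear a y z d = trans (distribʳ d (a * y) z) (+-congʳ (*-assoc a y d))

    s*[0*d]≈0 : ∀ s {x} d → x ≈ 0# → s * (x * d) ≈ 0#
    s*[0*d]≈0 s d x≈0 = trans (*-congˡ (trans (*-congʳ x≈0) (zeroˡ d))) (zeroʳ s)

    s*[x*0]≈0 : ∀ s x {d} → d ≈ 0# → s * (x * d) ≈ 0#
    s*[x*0]≈0 s x d≈0 = trans (*-congˡ (trans (*-congˡ d≈0) (zeroʳ x))) (zeroʳ s)

  det-linear : ∀ n (j₀ : Fin n) (a : Carrier) {M N Q : Matrix n} →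
               (∀ r c → c ≢ j₀ → M r c ≈ N r c) → (∀ r c → c ≢ j₀ → M r c ≈ Q r c) →
               (∀ r → M r j₀ ≈ a * N r j₀ + Q r j₀) → det n M ≈ a * det n N + det n Q
  det-linear (suc n) j₀ a {M} {N} {Q} M≈N M≈Q M≈aN+Q = begin
    sum (term M)                             ≈⟨ sum-cong-≋ term-linear ⟩
    sum (λ j → a * term N j + term Q j)      ≈⟨ ∑-distrib-+ (λ j → a * term N j) (term Q) ⟩
    sum (λ j → a * term N j) + sum (term Q)  ≈⟨ +-congʳ (sym (*-distribˡ-sum a (term N))) ⟩
    a * sum (term N) + sum (term Q)          ∎
    where
    term : Matrix (suc n) → Fin (suc n) → Carrier
    term K j = sign (toℕ j) * (K zero j * det n (minor j K))

    term-linear : ∀ j → term M j ≈ a * term N j + term Q j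
    term-linear j with j Fin.≟ j₀
    ... | yes ≡.refl = begin
      s * (M zero j * det n (minor j M))                      ≈⟨ *-congˡ (*-cong (M≈aN+Q zero) (det-cong n M≈N′)) ⟩
      s * ((a * N zero j + Q zero j) * det n (minor j N))     ≈⟨ *-congˡ (*-distribʳ-linear a _ _ _) ⟩
      s * (a * (N zero j * det n (minor j N)) + Q zero j * det n (minor j N))
        ≈⟨ *-distribˡ-linear s a _ _ ⟩
      a * term N j + s * (Q zero j * det n (minor j N))       ≈⟨ +-congˡ (*-congˡ (*-congˡ (det-cong n N≈Q′))) ⟩
      a * term N j + term Q j                                 ∎
      where
      s : Carrier
      s = sign (toℕ j)
      M≈N′ : ∀ r c → minor j M r c ≈ minor j N r c
      M≈N′ r c = M≈N (suc r) (punchIn j c) (Fin.punchInᵢ≢i j c)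
      N≈Q′ : ∀ r c → minor j N r c ≈ minor j Q r c
      N≈Q′ r c = trans (sym (M≈N′ r c)) (M≈Q (suc r) (punchIn j c) (Fin.punchInᵢ≢i j c))
    ... | no j≢j₀ = begin
      s * (M zero j * det n (minor j M))                                          ≈⟨ *-congˡ (*-congˡ minor-linear) ⟩
      s * (M zero j * (a * det n (minor j N) + det n (minor j Q)))                ≈⟨ *-congˡ (*-distribˡ-linear (M zero j) a _ _) ⟩
      s * (a * (M zero j * det n (minor j N)) + M zero j * det n (minor j Q))     ≈⟨ *-distribˡ-linear s a _ _ ⟩
      a * (s * (M zero j * det n (minor j N))) + s * (M zero j * det n (minor j Q))
        ≈⟨ +-cong (*-congˡ (*-congˡ (*-congʳ (M≈N zero j j≢j₀)))) (*-congˡ (*-congʳ (M≈Q zero j j≢j₀))) ⟩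
      a * term N j + term Q j                                                     ∎
      where
      s : Carrier
      s = sign (toℕ j)
      j₀′ : Fin n
      j₀′ = punchOut (j≢j₀)
      punchIn-j₀′ : punchIn j j₀′ ≡ j₀
      punchIn-j₀′ = Fin.punchIn-punchOut (j≢j₀)
      avoids-j₀ : ∀ c → c ≢ j₀′ → punchIn j c ≢ j₀
      avoids-j₀ c c≢j₀′ eq = c≢j₀′ (Fin.punchIn-injective j c j₀′ (≡.trans eq (≡.sym punchIn-j₀′)))
      minor-linear : det n (minor j M) ≈ a * det n (minor j N) + det n (minor j Q)
      minor-linear = det-linear n j₀′ a
        (λ r c c≢j₀′ → M≈N (suc r) (punchIn j c) (avoids-j₀ c c≢j₀′))
        (λ r c c≢j₀′ → M≈Q (suc r) (punchIn j c) (avoids-j₀ c c≢j₀′))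
        (λ r → ≡.subst (λ c → M (suc r) c ≈ a * N (suc r) c + Q (suc r) c) (≡.sym punchIn-j₀′) (M≈aN+Q (suc r)))

  det-zero-row : ∀ n (u : Fin n) (M : Matrix n) → (∀ c → M u c ≈ 0#) → det n M ≈ 0#
  det-zero-row (suc n) zero    M Mu≈0 = sum-zero λ j →
    s*[0*d]≈0 (sign (toℕ j)) (det n (minor j M)) (Mu≈0 j)
  det-zero-row (suc n) (suc u) M Mu≈0 = sum-zero λ j →
    s*[x*0]≈0 (sign (toℕ j)) (M zero j) (det-zero-row n u (minor j M) (Mu≈0 ∘ punchIn j))

  det-adjacent-equal-columns : ∀ n (i : Fin n) (M : Matrix (suc n)) →
                               (∀ r → M r (inject₁ i) ≈ M r (suc i)) → det (suc n) M ≈ 0#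
  det-adjacent-equal-columns (suc n) i M cols≈ = begin
    sum t                                           ≈⟨ sum-remove t ⟩
    t a + sum (removeAt t a)                        ≈⟨ +-congˡ (sum-remove (removeAt t a)) ⟩
    t a + (t (punchIn a i) + sum (removeAt (removeAt t a) i))
      ≈⟨ +-congˡ (+-cong (reflexive (≡.cong t (punchIn-inject₁-self i))) (sum-zero other-terms≈0)) ⟩
    t a + (t b + 0#)                                ≈⟨ +-congˡ (+-identityʳ (t b)) ⟩
    t a + t b                                       ≈⟨ +-congˡ tb≈-ta ⟩
    t a + - t a                                     ≈⟨ -‿inverseʳ (t a) ⟩
    0#                                              ∎
    where
    a b : Fin (suc (suc n))
    a = inject₁ i
    b = suc i
    t : Fin (suc (suc n)) → Carrier
    t j = sign (toℕ j) * (M zero j * det (suc n) (minor j M))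

    minor-b≈minor-a : ∀ r c → minor b M r c ≈ minor a M r c
    minor-b≈minor-a r c with c Fin.≟ i
    ... | yes ≡.refl = trans (reflexive (≡.cong (M (suc r)) (punchIn-suc-self c)))
                         (trans (cols≈ (suc r)) (reflexive (≡.cong (M (suc r)) (≡.sym (punchIn-inject₁-self c)))))
    ... | no c≢i = reflexive (≡.cong (M (suc r)) (≡.sym (punchIn-inject₁≡punchIn-suc i c c≢i)))

    tb≈-ta : t b ≈ - t a
    tb≈-ta = begin
      sign (suc (toℕ i)) * (M zero b * det (suc n) (minor b M))
        ≈⟨ *-cong (-‿cong (reflexive (≡.cong sign (≡.sym (Fin.toℕ-inject₁ i)))))
                  (*-cong (sym (cols≈ zero)) (det-cong (suc n) minor-b≈minor-a)) ⟩
      - sign (toℕ a) * (M zero a * det (suc n) (minor a M))       ≈⟨ -‿distribˡ-* _ _ ⟨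
      - t a                                                       ∎

    other-terms≈0 : ∀ c → t (punchIn a (punchIn i c)) ≈ 0#
    other-terms≈0 c with punchIn-adjacent i j (Fin.punchInᵢ≢i a (punchIn i c)) j≢b
      where
      j = punchIn a (punchIn i c)
      j≢b : j ≢ b
      j≢b eq = Fin.punchInᵢ≢i i c (Fin.punchIn-injective a (punchIn i c) i (≡.trans eq (≡.sym (punchIn-inject₁-self i))))
    ... | i′ , eq₁ , eq₂ = s*[x*0]≈0 (sign (toℕ j)) (M zero j) minor≈0
      where
      j = punchIn a (punchIn i c)
      minor≈0 : det (suc n) (minor j M) ≈ 0#
      minor≈0 = det-adjacent-equal-columns n i′ (minor j M) λ r →
        trans (reflexive (≡.cong (M (suc r)) eq₁)) (trans (cols≈ (suc r)) (reflexive (≡.cong (M (suc r)) (≡.sym eq₂))))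

  column : ∀ {n} → Matrix n → Fin n → Fin n → Carrier
  column M j r = M r j

  replaceColumn : ∀ {n} → Fin n → (Fin n → Carrier) → Matrix n → Matrix n
  replaceColumn j x M r c with c Fin.≟ j
  ... | yes _ = x r
  ... | no  _ = M r c

  replaceColumn-≡ : ∀ {n} j x (M : Matrix n) r → replaceColumn j x M r j ≡ x r
  replaceColumn-≡ j x M r with j Fin.≟ j
  ... | yes _   = ≡.refl
  ... | no j≢j = ⊥-elim (j≢j ≡.refl)

  replaceColumn-≢ : ∀ {n} j x (M : Matrix n) r {c} → c ≢ j → replaceColumn j x M r c ≡ M r c
  replaceColumn-≢ j x M r {c} c≢j with c Fin.≟ j
  ... | yes c≡j = ⊥-elim (c≢j c≡j)
  ... | no _    = ≡.refl

  replaceColumn-comm : ∀ {n} {a b : Fin n} → a ≢ b → ∀ x y M r c →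
                       replaceColumn a x (replaceColumn b y M) r c ≡ replaceColumn b y (replaceColumn a x M) r c
  replaceColumn-comm {a = a} {b} a≢b x y M r c = by-cases (c Fin.≟ a) (c Fin.≟ b)
    where
    lhs rhs : Fin _ → Carrier
    lhs c = replaceColumn a x (replaceColumn b y M) r c
    rhs c = replaceColumn b y (replaceColumn a x M) r c
    by-cases : Dec (c ≡ a) → Dec (c ≡ b) → lhs c ≡ rhs c
    by-cases (yes ≡.refl) _ = ≡.trans (replaceColumn-≡ a x _ r)
      (≡.sym (≡.trans (replaceColumn-≢ b y _ r a≢b) (replaceColumn-≡ a x M r)))
    by-cases (no c≢a) (yes ≡.refl) = ≡.trans (replaceColumn-≢ a x _ r c≢a)
      (≡.trans (replaceColumn-≡ b y M r) (≡.sym (replaceColumn-≡ b y _ r)))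
    by-cases (no c≢a) (no c≢b) = ≡.trans (replaceColumn-≢ a x _ r c≢a) (≡.trans (replaceColumn-≢ b y M r c≢b)
      (≡.sym (≡.trans (replaceColumn-≢ b y _ r c≢b) (replaceColumn-≢ a x M r c≢a))))

  det-replaceColumn-cong : ∀ n j {x y} (M : Matrix n) → (∀ r → x r ≈ y r) →
                           det n (replaceColumn j x M) ≈ det n (replaceColumn j y M)
  det-replaceColumn-cong n j {x} {y} M x≈y = det-cong n λ r c → lemma r c
    where
    lemma : ∀ r c → replaceColumn j x M r c ≈ replaceColumn j y M r c
    lemma r c with c Fin.≟ j
    ... | yes _ = x≈y r
    ... | no  _ = refl

  det-replaceColumn-linear : ∀ n j a {x y z} (M : Matrix n) → (∀ r → x r ≈ a * y r + z r) →
                             det n (replaceColumn j x M) ≈ a * det n (replaceColumn j y M) + det n (replaceColumn j z M)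
  det-replaceColumn-linear n j a {x} {y} {z} M x≈ay+z = det-linear n j a off off λ r → begin
    replaceColumn j x M r j                                   ≡⟨ replaceColumn-≡ j x M r ⟩
    x r                                                       ≈⟨ x≈ay+z r ⟩
    a * y r + z r
      ≡⟨ ≡.cong₂ (λ u v → a * u + v) (replaceColumn-≡ j y M r) (replaceColumn-≡ j z M r) ⟨
    a * replaceColumn j y M r j + replaceColumn j z M r j     ∎
    where
    off : ∀ {v w} r c → c ≢ j → replaceColumn j v M r c ≈ replaceColumn j w M r c
    off {v} {w} r c c≢j = reflexive (≡.trans (replaceColumn-≢ j v M r c≢j) (≡.sym (replaceColumn-≢ j w M r c≢j)))

  det-replaceColumn-+ : ∀ n j {x y z} (M : Matrix n) → (∀ r → x r ≈ y r + z r) →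
                        det n (replaceColumn j x M) ≈ det n (replaceColumn j y M) + det n (replaceColumn j z M)
  det-replaceColumn-+ n j M x≈y+z =
    trans (det-replaceColumn-linear n j 1# M λ r → trans (x≈y+z r) (+-congʳ (sym (*-identityˡ _))))
          (+-congʳ (*-identityˡ _))

  det-zero-column : ∀ n j (M : Matrix n) → det n (replaceColumn j (λ _ → 0#) M) ≈ 0#
  det-zero-column n j M = x+x≈x⇒x≈0 _ (sym (det-replaceColumn-+ n j M λ _ → sym (+-identityʳ 0#)))

  det-replaceColumn-* : ∀ n j a {x} (M : Matrix n) →
                        det n (replaceColumn j (λ r → a * x r) M) ≈ a * det n (replaceColumn j x M)
  det-replaceColumn-* n j a M = begin
    det n (replaceColumn j _ M)                                    ≈⟨ det-replaceColumn-linear n j a M (λ _ → sym (+-identityʳ _)) ⟩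
    a * det n (replaceColumn j _ M) + det n (replaceColumn j _ M)  ≈⟨ +-congˡ (det-zero-column n j M) ⟩
    a * det n (replaceColumn j _ M) + 0#                           ≈⟨ +-identityʳ _ ⟩
    a * det n (replaceColumn j _ M)                                ∎

  det-replaceColumn-sum : ∀ n j {m} (V : Fin m → Fin n → Carrier) (M : Matrix n) →
                          det n (replaceColumn j (λ r → sum λ i → V i r) M) ≈ sum (λ i → det n (replaceColumn j (V i) M))
  det-replaceColumn-sum n j {zero}  V M = det-zero-column n j M
  det-replaceColumn-sum n j {suc m} V M = trans (det-replaceColumn-+ n j M (λ _ → refl))
                                                (+-congˡ (det-replaceColumn-sum n j (V ∘ suc) M))

  replaceColumn-self : ∀ {n} j (M : Matrix n) r c → replaceColumn j (column M j) M r c ≡ M r c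
  replaceColumn-self j M r c with c Fin.≟ j
  ... | yes ≡.refl = ≡.refl
  ... | no  _      = ≡.refl

  swapAdjacentColumns : ∀ {n} → Fin n → Matrix (suc n) → Matrix (suc n)
  swapAdjacentColumns i M =
    replaceColumn (inject₁ i) (column M (suc i)) (replaceColumn (suc i) (column M (inject₁ i)) M)

  det-swapAdjacentColumns : ∀ n (i : Fin n) (M : Matrix (suc n)) →
                            det (suc n) (swapAdjacentColumns i M) ≈ - det (suc n) M
  det-swapAdjacentColumns n i M = +-inverseʳ-unique (det′ M) (det′ (V B A)) (begin
    det′ M + det′ (V B A)                                                ≈⟨ +-congʳ (det-cong (suc n) V-A-B≈M) ⟨
    det′ (V A B) + det′ (V B A)                                          ≈⟨ +-cong (+-identityˡ _) (+-identityʳ _) ⟨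
    (0# + det′ (V A B)) + (det′ (V B A) + 0#)                            ≈⟨ +-cong (+-congʳ (V-equal A)) (+-congˡ (V-equal B)) ⟨
    (det′ (V A A) + det′ (V A B)) + (det′ (V B A) + det′ (V B B))        ≈⟨ +-cong (V-additiveʳ A) (V-additiveʳ B) ⟨
    det′ (V A S) + det′ (V B S)                                          ≈⟨ det-replaceColumn-+ (suc n) a _ (λ _ → refl) ⟨
    det′ (V S S)                                                         ≈⟨ V-equal S ⟩
    0#                                                                   ∎)
    where
    det′ : Matrix (suc n) → Carrier
    det′ = det (suc n)
    a b : Fin (suc n)
    a = inject₁ i
    b = suc i
    a≢b : a ≢ b
    a≢b = inject₁≢suc i
    A B S : Fin (suc n) → Carrier
    A = column M a
    B = column M b
    S r = A r + B r
    V : (Fin (suc n) → Carrier) → (Fin (suc n) → Carrier) → Matrix (suc n)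
    V x y = replaceColumn a x (replaceColumn b y M)

    V-equal : ∀ x → det′ (V x x) ≈ 0#
    V-equal x = det-adjacent-equal-columns n i (V x x) λ r → reflexive (≡.trans (replaceColumn-≡ a x (replaceColumn b x M) r)
      (≡.sym (≡.trans (replaceColumn-≢ a x (replaceColumn b x M) r (a≢b ∘ ≡.sym)) (replaceColumn-≡ b x M r))))

    V-additiveʳ : ∀ x → det′ (V x S) ≈ det′ (V x A) + det′ (V x B)
    V-additiveʳ x = begin
      det′ (V x S)
        ≈⟨ det-cong (suc n) (λ r c → reflexive (replaceColumn-comm a≢b x S M r c)) ⟩
      det′ (replaceColumn b S (replaceColumn a x M))                       ≈⟨ det-replaceColumn-+ (suc n) b _ (λ _ → refl) ⟩
      det′ (replaceColumn b A (replaceColumn a x M)) + det′ (replaceColumn b B (replaceColumn a x M))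
        ≈⟨ +-cong (det-cong (suc n) (λ r c → reflexive (replaceColumn-comm a≢b x A M r c)))
                  (det-cong (suc n) (λ r c → reflexive (replaceColumn-comm a≢b x B M r c))) ⟨
      det′ (V x A) + det′ (V x B)                                          ∎

    V-A-B≈M : ∀ r c → V A B r c ≈ M r c
    V-A-B≈M r c = reflexive (by-cases (c Fin.≟ a))
      where
      by-cases : Dec (c ≡ a) → V A B r c ≡ M r c
      by-cases (yes ≡.refl) = replaceColumn-≡ a A (replaceColumn b B M) r
      by-cases (no c≢a)     = ≡.trans (replaceColumn-≢ a A (replaceColumn b B M) r c≢a) (replaceColumn-self b M r c)

  private
    det-equal-columns-< : ∀ k n (a b : Fin n) (M : Matrix n) → toℕ b ≡ k → toℕ a ℕ.< toℕ b →
                          (∀ r → M r a ≈ M r b) → det n M ≈ 0#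
    det-equal-columns-< (suc k) (suc n) a (suc b) M b≡k a<b cols≈ with a Fin.≟ inject₁ b
    ... | yes ≡.refl = det-adjacent-equal-columns n b M cols≈
    ... | no a≢b = begin
      det (suc n) M                                       ≈⟨ -‿involutive _ ⟨
      - - det (suc n) M                                   ≈⟨ -‿cong (det-swapAdjacentColumns n b M) ⟨
      - det (suc n) (swapAdjacentColumns b M)             ≈⟨ -‿cong swapped≈0 ⟩
      - 0#                                                ≈⟨ -0#≈0# ⟩
      0#                                                  ∎
      where
      a≢1+b : a ≢ suc b
      a≢1+b eq = ℕ.<-irrefl (≡.cong toℕ eq) a<b
      toℕ-b≢a : toℕ a ≢ toℕ (inject₁ b)
      toℕ-b≢a eq = a≢b (Fin.toℕ-injective eq)
      swapped≈0 : det (suc n) (swapAdjacentColumns b M) ≈ 0#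
      swapped≈0 = det-equal-columns-< k (suc n) a (inject₁ b) (swapAdjacentColumns b M)
        (≡.trans (Fin.toℕ-inject₁ b) (ℕ.suc-injective b≡k))
        (ℕ.≤∧≢⇒< (≡.subst (toℕ a ℕ.≤_) (≡.sym (Fin.toℕ-inject₁ b)) (ℕ.≤-pred a<b)) toℕ-b≢a)
        λ r → begin
          swapAdjacentColumns b M r a
            ≡⟨ ≡.trans (replaceColumn-≢ (inject₁ b) _ _ r a≢b) (replaceColumn-≢ (suc b) _ M r a≢1+b) ⟩
          M r a                               ≈⟨ cols≈ r ⟩
          M r (suc b)                         ≡⟨ replaceColumn-≡ (inject₁ b) (column M (suc b)) _ r ⟨
          swapAdjacentColumns b M r (inject₁ b) ∎

  det-equal-columns : ∀ n {a b : Fin n} (M : Matrix n) → a ≢ b → (∀ r → M r a ≈ M r b) → det n M ≈ 0#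
  det-equal-columns n {a} {b} M a≢b cols≈ with ℕ.<-cmp (toℕ a) (toℕ b)
  ... | tri< a<b _ _ = det-equal-columns-< (toℕ b) n a b M ≡.refl a<b cols≈
  ... | tri≈ _ a≡b _ = ⊥-elim (a≢b (Fin.toℕ-injective a≡b))
  ... | tri> _ _ b<a = det-equal-columns-< (toℕ a) n b a M ≡.refl b<a (sym ∘ cols≈)

  private
    sign-suc-suc : ∀ k → sign (suc (suc k)) ≈ sign k
    sign-suc-suc k = -‿involutive (sign k)

  sign-punchIn : ∀ {m} (v : Fin (suc (suc m))) (j v′ : Fin (suc m)) → punchIn (punchIn v j) v′ ≡ v →
                 sign (toℕ (punchIn v j) ℕ.+ toℕ v′) ≈ sign (suc (toℕ v ℕ.+ toℕ j))
  sign-punchIn zero    j       zero     eq = reflexive (≡.cong (sign ∘ suc) (ℕ.+-identityʳ (toℕ j)))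
  sign-punchIn (suc v) zero    v′       eq with Fin.suc-injective eq
  ... | ≡.refl = sym (trans (sign-suc-suc (toℕ v′ ℕ.+ 0)) (reflexive (≡.cong sign (ℕ.+-identityʳ (toℕ v′)))))
  sign-punchIn {suc m} (suc v) (suc j) (suc v′) eq = begin
    sign (suc (toℕ (punchIn v j)) ℕ.+ suc (toℕ v′))    ≡⟨ ≡.cong (sign ∘ suc) (ℕ.+-suc (toℕ (punchIn v j)) (toℕ v′)) ⟩
    sign (suc (suc (toℕ (punchIn v j) ℕ.+ toℕ v′)))    ≈⟨ sign-suc-suc (toℕ (punchIn v j) ℕ.+ toℕ v′) ⟩
    sign (toℕ (punchIn v j) ℕ.+ toℕ v′)                ≈⟨ sign-punchIn v j v′ (Fin.suc-injective eq) ⟩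
    sign (suc (toℕ v ℕ.+ toℕ j))                       ≡⟨ ≡.cong sign (ℕ.+-suc (toℕ v) (toℕ j)) ⟨
    sign (toℕ v ℕ.+ suc (toℕ j))                       ≈⟨ sign-suc-suc (toℕ v ℕ.+ suc (toℕ j)) ⟨
    sign (suc (suc (toℕ v ℕ.+ suc (toℕ j))))           ∎

  sign-cofactor : ∀ {m} u (v : Fin (suc (suc m))) (j′ v′ : Fin (suc m)) → punchIn (punchIn v j′) v′ ≡ v →
                  sign (toℕ (punchIn v j′)) * sign (u ℕ.+ toℕ v′) ≈ sign (suc (u ℕ.+ toℕ v)) * sign (toℕ j′)
  sign-cofactor {m} u v j′ v′ punchIn-v′ = begin
    sign (toℕ j) * sign (u ℕ.+ toℕ v′)              ≈⟨ sign-+ (toℕ j) _ ⟨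
    sign (toℕ j ℕ.+ (u ℕ.+ toℕ v′))                 ≡⟨ ≡.cong sign (x∙yz≈y∙xz (toℕ j) u (toℕ v′)) ⟩
    sign (u ℕ.+ (toℕ j ℕ.+ toℕ v′))                 ≈⟨ sign-+ u _ ⟩
    sign u * sign (toℕ j ℕ.+ toℕ v′)                ≈⟨ *-congˡ (sign-punchIn v j′ v′ punchIn-v′) ⟩
    sign u * sign (suc (toℕ v ℕ.+ toℕ j′))          ≈⟨ sign-+ u _ ⟨
    sign (u ℕ.+ suc (toℕ v ℕ.+ toℕ j′))             ≡⟨ ≡.cong sign (ℕ.+-suc u _) ⟩
    sign (suc (u ℕ.+ (toℕ v ℕ.+ toℕ j′)))           ≡⟨ ≡.cong (sign ∘ suc) (ℕ.+-assoc u (toℕ v) (toℕ j′)) ⟨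
    sign (suc (u ℕ.+ toℕ v) ℕ.+ toℕ j′)             ≈⟨ sign-+ (suc (u ℕ.+ toℕ v)) (toℕ j′) ⟩
    sign (suc (u ℕ.+ toℕ v)) * sign (toℕ j′)        ∎
    where
    j : Fin (suc (suc m))
    j = punchIn v j′

  det-single-entry-row : ∀ n (u v : Fin (suc n)) (M : Matrix (suc n)) → (∀ c → c ≢ v → M u c ≈ 0#) →
                         det (suc n) M ≈ sign (toℕ u ℕ.+ toℕ v) * (M u v * det n (submatrix u v M))
  det-single-entry-row n zero v M row≈0 = sum-single v _ λ j j≢v →
    s*[0*d]≈0 (sign (toℕ j)) (det n (minor j M)) (row≈0 j j≢v)
  det-single-entry-row (suc n) (suc u) v M row≈0 = begin
    sum t                                              ≈⟨ sum-remove t ⟩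
    t v + sum (removeAt t v)                           ≈⟨ +-congʳ tv≈0 ⟩
    0# + sum (removeAt t v)                            ≈⟨ +-identityˡ _ ⟩
    sum (removeAt t v)                                 ≈⟨ sum-cong-≋ other-terms ⟩
    sum (λ j′ → s * (M (suc u) v * g j′))              ≈⟨ *-distribˡ-sum s (λ j′ → M (suc u) v * g j′) ⟨
    s * sum (λ j′ → M (suc u) v * g j′)                ≈⟨ *-congˡ (*-distribˡ-sum (M (suc u) v) g) ⟨
    s * (M (suc u) v * sum g)                          ∎
    where
    s : Carrier
    s = sign (suc (toℕ u ℕ.+ toℕ v))
    t : Fin (suc (suc n)) → Carrier
    t j = sign (toℕ j) * (M zero j * det (suc n) (minor j M))
    g : Fin (suc n) → Carrier
    g j′ = sign (toℕ j′) * (M zero (punchIn v j′) * det n (minor j′ (submatrix (suc u) v M)))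

    tv≈0 : t v ≈ 0#
    tv≈0 = s*[x*0]≈0 (sign (toℕ v)) (M zero v)
      (det-zero-row (suc n) u (minor v M) λ c → row≈0 (punchIn v c) (Fin.punchInᵢ≢i v c))

    regroup : ∀ s₁ x s₂ m d → s₁ * (x * (s₂ * (m * d))) ≈ (s₁ * s₂) * (m * (x * d))
    regroup = solve 5 (λ s₁ x s₂ m d → s₁ ⊕ (x ⊕ (s₂ ⊕ (m ⊕ d))) ⊜ (s₁ ⊕ s₂) ⊕ (m ⊕ (x ⊕ d))) refl
    regroup-signs : ∀ s s′ m y → (s * s′) * (m * y) ≈ s * (m * (s′ * y))
    regroup-signs = solve 4 (λ s s′ m y → (s ⊕ s′) ⊕ (m ⊕ y) ⊜ s ⊕ (m ⊕ (s′ ⊕ y))) refl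

    other-terms : ∀ j′ → t (punchIn v j′) ≈ s * (M (suc u) v * g j′)
    other-terms j′ = begin
      sign (toℕ j) * (M zero j * det (suc n) (minor j M))
        ≈⟨ *-congˡ (*-congˡ minor-expansion) ⟩
      sign (toℕ j) * (M zero j * (sign (toℕ u ℕ.+ toℕ v′) * (M (suc u) v * D)))
        ≈⟨ regroup (sign (toℕ j)) (M zero j) (sign (toℕ u ℕ.+ toℕ v′)) (M (suc u) v) D ⟩
      (sign (toℕ j) * sign (toℕ u ℕ.+ toℕ v′)) * (M (suc u) v * (M zero j * D))
        ≈⟨ *-congʳ (sign-cofactor (toℕ u) v j′ v′ punchIn-v′) ⟩
      (s * sign (toℕ j′)) * (M (suc u) v * (M zero j * D))
        ≈⟨ regroup-signs s (sign (toℕ j′)) (M (suc u) v) (M zero j * D) ⟩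
      s * (M (suc u) v * g j′) ∎
      where
      j : Fin (suc (suc n))
      j = punchIn v j′
      v≢j : v ≢ j
      v≢j = Fin.punchInᵢ≢i v j′ ∘ ≡.sym
      v′ : Fin (suc n)
      v′ = punchOut (v≢j ∘ ≡.sym)
      punchIn-v′ : punchIn j v′ ≡ v
      punchIn-v′ = Fin.punchIn-punchOut (v≢j ∘ ≡.sym)
      D : Carrier
      D = det n (minor j′ (submatrix (suc u) v M))
      minor-expansion : det (suc n) (minor j M) ≈ sign (toℕ u ℕ.+ toℕ v′) * (M (suc u) v * D)
      minor-expansion = begin
        det (suc n) (minor j M)
          ≈⟨ det-single-entry-row n u v′ (minor j M) (λ c c≢v′ → row≈0 (punchIn j c)
               (c≢v′ ∘ Fin.punchIn-injective j c v′ ∘ flip ≡.trans (≡.sym punchIn-v′))) ⟩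
        sign (toℕ u ℕ.+ toℕ v′) * (M (suc u) (punchIn j v′) * det n (submatrix u v′ (minor j M)))
          ≈⟨ *-congˡ (*-cong (reflexive (≡.cong (M (suc u)) punchIn-v′))
               (det-cong n λ r c → reflexive (≡.cong (M (suc (punchIn u r))) (punchIn-punchIn v j′ v′ c punchIn-v′)))) ⟩
        sign (toℕ u ℕ.+ toℕ v′) * (M (suc u) v * D) ∎

  det-add-column-multiple : ∀ n {j w : Fin n} (a : Carrier) {M T : Matrix n} → j ≢ w →
                            (∀ r c → c ≢ j → T r c ≈ M r c) → (∀ r → T r j ≈ M r j + a * M r w) → det n T ≈ det n M
  det-add-column-multiple n {j} {w} a {M} {T} j≢w T≈M T≈M+aM = begin
    det n T                       ≈⟨ det-linear n j a (λ r c c≢j → trans (T≈M r c c≢j) (sym (N≈M r c≢j))) T≈M T-j ⟩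
    a * det n N + det n M         ≈⟨ +-congʳ (trans (*-congˡ repeated-column) (zeroʳ a)) ⟩
    0# + det n M                  ≈⟨ +-identityˡ _ ⟩
    det n M                       ∎
    where
    N : Matrix n
    N = replaceColumn j (column M w) M
    N≈M : ∀ r {c} → c ≢ j → N r c ≈ M r c
    N≈M r c≢j = reflexive (replaceColumn-≢ j (column M w) M r c≢j)
    T-j : ∀ r → T r j ≈ a * N r j + M r j
    T-j r = trans (T≈M+aM r) (trans (+-comm _ _) (+-congʳ (*-congˡ (sym (reflexive (replaceColumn-≡ j (column M w) M r))))))
    repeated-column : det n N ≈ 0#
    repeated-column = det-equal-columns n N j≢w λ r →
      reflexive (≡.trans (replaceColumn-≡ j (column M w) M r) (≡.sym (replaceColumn-≢ j (column M w) M r (j≢w ∘ ≡.sym))))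

  private
    toℕ≡⇒≡fromℕ< : ∀ {n k} (k<n : k ℕ.< n) {c : Fin n} → toℕ c ≡ k → c ≡ Fin.fromℕ< k<n
    toℕ≡⇒≡fromℕ< k<n c≡k = Fin.toℕ-injective (≡.trans c≡k (≡.sym (Fin.toℕ-fromℕ< k<n)))

    unchanged-shrink : ∀ {n k} {u : Fin n} {T M : Matrix n} → (∀ c → toℕ c ≡ k → c ≡ u) →
                       (∀ r c → c ≡ u ⊎ suc k ℕ.≤ toℕ c → T r c ≈ M r c) → (∀ r c → c ≡ u ⊎ k ℕ.≤ toℕ c → T r c ≈ M r c)
    unchanged-shrink only-u unchanged r c (inj₁ c≡u) = unchanged r c (inj₁ c≡u)
    unchanged-shrink {k = k} only-u unchanged r c (inj₂ k≤c) with toℕ c ℕ.≟ k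
    ... | yes c≡k = unchanged r c (inj₁ (only-u c c≡k))
    ... | no  c≢k = unchanged r c (inj₂ (ℕ.≤∧≢⇒< k≤c (c≢k ∘ ≡.sym)))

    -- Induction on k: the columns c ≢ u with toℕ c < k are the ones already modified.
    det-add-multiples-< : ∀ n (u : Fin n) (h : Fin n → Carrier) (M : Matrix n) k (T : Matrix n) →
                          (∀ r c → c ≡ u ⊎ k ℕ.≤ toℕ c → T r c ≈ M r c) →
                          (∀ r c → c ≢ u → toℕ c ℕ.< k → T r c ≈ M r c + h c * M r u) →
                          det n T ≈ det n M
    det-add-multiples-< n u h M zero T unchanged _ = det-cong n λ r c → unchanged r c (inj₂ ℕ.z≤n)
    det-add-multiples-< n u h M (suc k) T unchanged changed with k ℕ.<? n
    ... | no k≮n = det-add-multiples-< n u h M k T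
      (unchanged-shrink (λ c c≡k → ⊥-elim (k≮n (≡.subst (ℕ._< n) c≡k (Fin.toℕ<n c)))) unchanged)
      (λ r c c≢u c<k → changed r c c≢u (ℕ.m<n⇒m<1+n c<k))
    ... | yes k<n with Fin.fromℕ< k<n Fin.≟ u
    ...   | yes c₀≡u = det-add-multiples-< n u h M k T
      (unchanged-shrink (λ c c≡k → ≡.trans (toℕ≡⇒≡fromℕ< k<n c≡k) c₀≡u) unchanged)
      (λ r c c≢u c<k → changed r c c≢u (ℕ.m<n⇒m<1+n c<k))
    ...   | no c₀≢u = begin
      det n T     ≈⟨ det-add-column-multiple n (h c₀) c₀≢u (λ r c c≢c₀ → sym (reflexive (T′-other r c≢c₀))) T-c₀ ⟩
      det n T′    ≈⟨ det-add-multiples-< n u h M k T′ unchanged′ changed′ ⟩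
      det n M     ∎
      where
      c₀ : Fin n
      c₀ = Fin.fromℕ< k<n
      T′ : Matrix n
      T′ = replaceColumn c₀ (column M c₀) T
      T′-c₀ : ∀ r → T′ r c₀ ≡ M r c₀
      T′-c₀ = replaceColumn-≡ c₀ (column M c₀) T
      T′-other : ∀ r {c} → c ≢ c₀ → T′ r c ≡ T r c
      T′-other = replaceColumn-≢ c₀ (column M c₀) T
      T-c₀ : ∀ r → T r c₀ ≈ T′ r c₀ + h c₀ * T′ r u
      T-c₀ r = begin
        T r c₀                        ≈⟨ changed r c₀ c₀≢u (ℕ.≤-reflexive (≡.cong suc (Fin.toℕ-fromℕ< k<n))) ⟩
        M r c₀ + h c₀ * M r u         ≈⟨ +-congˡ (*-congˡ (unchanged r u (inj₁ ≡.refl))) ⟨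
        M r c₀ + h c₀ * T r u         ≡⟨ ≡.cong₂ (λ x y → x + h c₀ * y) (T′-c₀ r) (T′-other r (c₀≢u ∘ ≡.sym)) ⟨
        T′ r c₀ + h c₀ * T′ r u       ∎
      unchanged′ : ∀ r c → c ≡ u ⊎ k ℕ.≤ toℕ c → T′ r c ≈ M r c
      unchanged′ r c c-cases = by-cases (c Fin.≟ c₀)
       where
       by-cases : Dec (c ≡ c₀) → T′ r c ≈ M r c
       by-cases (yes ≡.refl) = reflexive (T′-c₀ r)
       by-cases (no c≢c₀) = trans (reflexive (T′-other r c≢c₀)) (unchanged r c (widen c-cases))
        where
        widen : c ≡ u ⊎ k ℕ.≤ toℕ c → c ≡ u ⊎ suc k ℕ.≤ toℕ c
        widen (inj₁ c≡u) = inj₁ c≡u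
        widen (inj₂ k≤c) = inj₂ (ℕ.≤∧≢⇒< k≤c (c≢c₀ ∘ toℕ≡⇒≡fromℕ< k<n ∘ ≡.sym))
      changed′ : ∀ r c → c ≢ u → toℕ c ℕ.< k → T′ r c ≈ M r c + h c * M r u
      changed′ r c c≢u c<k = trans (reflexive (T′-other r c≢c₀)) (changed r c c≢u (ℕ.m<n⇒m<1+n c<k))
        where
        c≢c₀ : c ≢ c₀
        c≢c₀ ≡.refl = ℕ.<-irrefl (Fin.toℕ-fromℕ< k<n) c<k

  det-add-multiples-of-column : ∀ n (u : Fin n) (h : Fin n → Carrier) {M T : Matrix n} →
                                (∀ r → T r u ≈ M r u) → (∀ r c → c ≢ u → T r c ≈ M r c + h c * M r u) →
                                det n T ≈ det n M
  det-add-multiples-of-column n u h {M} {T} column-u other-columns =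
    det-add-multiples-< n u h M n T unchanged (λ r c c≢u _ → other-columns r c c≢u)
    where
    unchanged : ∀ r c → c ≡ u ⊎ n ℕ.≤ toℕ c → T r c ≈ M r c
    unchanged r c (inj₁ ≡.refl) = column-u r
    unchanged r c (inj₂ n≤c)    = ⊥-elim (ℕ.<⇒≱ (Fin.toℕ<n c) n≤c)

  det-add-other-columns : ∀ n (M : Matrix (suc n)) u → det (suc n) (replaceColumn u (λ r → sum (M r)) M) ≈ det (suc n) M
  det-add-other-columns n M u = begin
    det′ (replaceColumn u (λ r → sum (M r)) M)
      ≈⟨ det-replaceColumn-+ (suc n) u M (λ r → sum-remove (M r)) ⟩
    det′ (replaceColumn u (column M u) M) + det′ (replaceColumn u (λ r → sum (removeAt (M r) u)) M)
      ≈⟨ +-cong (det-cong (suc n) (λ r c → reflexive (replaceColumn-self u M r c)))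
                (det-replaceColumn-sum (suc n) u (λ i r → M r (punchIn u i)) M) ⟩
    det′ M + sum (λ i → det′ (replaceColumn u (column M (punchIn u i)) M))
      ≈⟨ +-congˡ (sum-zero repeated-column) ⟩
    det′ M + 0#                                                                 ≈⟨ +-identityʳ _ ⟩
    det′ M                                                                      ∎
    where
    det′ : Matrix (suc n) → Carrier
    det′ = det (suc n)
    repeated-column : ∀ i → det′ (replaceColumn u (column M (punchIn u i)) M) ≈ 0#
    repeated-column i = det-equal-columns (suc n) (replaceColumn u (column M (punchIn u i)) M) u≢i λ r → reflexive
      (≡.trans (replaceColumn-≡ u (column M (punchIn u i)) M r) (≡.sym (replaceColumn-≢ u (column M (punchIn u i)) M r (u≢i ∘ ≡.sym))))
      where
      u≢i : u ≢ punchIn u i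
      u≢i = Fin.punchInᵢ≢i u i ∘ ≡.sym

  det-constant-row-sums : ∀ n (M : Matrix (suc n)) (u : Fin (suc n)) (ρ : Carrier) → (∀ r → sum (M r) ≈ ρ) →
                          det (suc n) M ≈ ρ * det n (λ r c → M (punchIn u r) (punchIn u c) - M u (punchIn u c))
  det-constant-row-sums n M u ρ row-sum = begin
    det′ M                                                     ≈⟨ det-add-other-columns n M u ⟨
    det′ (replaceColumn u (λ r → sum (M r)) M)
      ≈⟨ det-replaceColumn-cong (suc n) u M (λ r → trans (row-sum r) (sym (*-identityʳ ρ))) ⟩
    det′ (replaceColumn u (λ _ → ρ * 1#) M)                    ≈⟨ det-replaceColumn-* (suc n) u ρ M ⟩
    ρ * det′ N
      ≈⟨ *-congˡ (det-add-multiples-of-column (suc n) u (λ c → - M u c) T-u T-other) ⟨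
    ρ * det′ T                                                 ≈⟨ *-congˡ (det-single-entry-row n u u T T-row-u) ⟩
    ρ * (sign (toℕ u ℕ.+ toℕ u) * (T u u * det n (submatrix u u T)))
      ≈⟨ *-congˡ (trans (*-congʳ (sign[k+k]≈1# (toℕ u))) (*-identityˡ _)) ⟩
    ρ * (T u u * det n (submatrix u u T))                      ≈⟨ *-congˡ (*-congʳ (reflexive (replaceColumn-≡ u _ _ u))) ⟩
    ρ * (1# * det n (submatrix u u T))                         ≈⟨ *-congˡ (*-identityˡ _) ⟩
    ρ * det n (submatrix u u T)
      ≈⟨ *-congˡ (det-cong n λ r c → reflexive (replaceColumn-≢ u _ _ _ (Fin.punchInᵢ≢i u c))) ⟩
    ρ * det n (λ r c → M (punchIn u r) (punchIn u c) - M u (punchIn u c)) ∎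
    where
    det′ : Matrix (suc n) → Carrier
    det′ = det (suc n)
    N T : Matrix (suc n)
    N = replaceColumn u (λ _ → 1#) M
    T = replaceColumn u (λ _ → 1#) (λ r c → M r c - M u c)

    T-u : ∀ r → T r u ≈ N r u
    T-u r = reflexive (≡.trans (replaceColumn-≡ u _ _ r) (≡.sym (replaceColumn-≡ u _ M r)))

    T-other : ∀ r c → c ≢ u → T r c ≈ N r c + - M u c * N r u
    T-other r c c≢u = begin
      T r c                        ≡⟨ replaceColumn-≢ u _ _ r c≢u ⟩
      M r c - M u c                ≈⟨ +-congˡ (*-identityʳ _) ⟨
      M r c + - M u c * 1#         ≡⟨ ≡.cong₂ (λ x y → x + - M u c * y) (replaceColumn-≢ u _ M r c≢u) (replaceColumn-≡ u _ M r) ⟨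
      N r c + - M u c * N r u      ∎

    T-row-u : ∀ c → c ≢ u → T u c ≈ 0#
    T-row-u c c≢u = trans (reflexive (replaceColumn-≢ u _ _ u c≢u)) (-‿inverseʳ (M u c))

module PolynomialDeterminant where

  open import Defs using (Poly; det; sumP; _*P_; _+P_)
  open Polynomials
  open import Data.Nat using (ℕ; zero; suc)
  open import Data.Fin using (Fin; zero; suc; toℕ)
  open import Data.List using (map; allFin; tabulate)
  open import Data.List.Properties using (map-tabulate)
  open import Data.Product using (∃; _,_; proj₁; proj₂)
  open import Function using (id)
  open import Relation.Binary.PropositionalEquality as ≡ using (_≡_)
  open import Algebra.Bundles using (CommutativeRing)

  open CommutativeRing Poly-commutativeRing using (_≈_; refl; sym; trans; *-congˡ; *-congʳ; *-identityˡ)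
  module D = Determinant Poly-commutativeRing
  open D using (Matrix; sign; minor)
  open import Algebra.Properties.Ring (CommutativeRing.ring Poly-commutativeRing) using (-‿involutive; -1*x≈-x)
  open import Algebra.Properties.Semiring.Sum (CommutativeRing.semiring Poly-commutativeRing) using (sum; sum-cong-≋)

  private
    -- Defs.det applies a sign function local to its where-block; unification names it σ.
    det-terms : ∀ n (M : Matrix (suc n)) → ∃ λ τ → det (suc n) M ≡ sumP (map τ (allFin (suc n)))
    det-terms n M = _ , ≡.refl

    det-signs : ∀ n (M : Matrix (suc n)) → ∃ λ (σ : ℕ → Poly → Poly) →
                ∀ k q j → toℕ j ≡ k → M zero j *P det n (minor j M) ≡ q → proj₁ (det-terms n M) j ≡ σ k q
    det-signs n M = _ , name-σ
      where
      name-σ : ∀ k q j → toℕ j ≡ k → M zero j *P det n (minor j M) ≡ q → proj₁ (det-terms n M) j ≡ _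
      name-σ k q j e₁ e₂ rewrite e₁ | e₂ = ≡.refl

    sign-σ : ∀ n (M : Matrix (suc n)) k q → proj₁ (det-signs n M) k q ≈ sign k *P q
    sign-σ n M zero          q = sym (*-identityˡ q)
    sign-σ n M (suc zero)    q = sym (-1*x≈-x q)
    sign-σ n M (suc (suc k)) q = trans (sign-σ n M k q) (*-congʳ (sym (-‿involutive (sign k))))

    sumP-tabulate : ∀ {m} (g : Fin m → Poly) → sumP (tabulate g) ≡ sum g
    sumP-tabulate {zero}  g = ≡.refl
    sumP-tabulate {suc m} g = ≡.cong (g zero +P_) (sumP-tabulate (λ i → g (suc i)))

  det≈det : ∀ n (M : Matrix n) → det n M ≈ D.det n M
  det≈det zero    M = refl
  det≈det (suc n) M = begin
    det (suc n) M                      ≡⟨ proj₂ (det-terms n M) ⟩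
    sumP (map τ (allFin (suc n)))      ≡⟨ ≡.cong sumP (map-tabulate id τ) ⟩
    sumP (tabulate τ)                  ≡⟨ sumP-tabulate τ ⟩
    sum τ                              ≈⟨ sum-cong-≋ τ≈ ⟩
    D.det (suc n) M                    ∎
    where
    open import Relation.Binary.Reasoning.Setoid (CommutativeRing.setoid Poly-commutativeRing)
    τ : Fin (suc n) → Poly
    τ = proj₁ (det-terms n M)
    τ≈ : ∀ j → τ j ≈ sign (toℕ j) *P (M zero j *P D.det n (minor j M))
    τ≈ j = begin
      τ j                                                ≡⟨ proj₂ (det-signs n M) (toℕ j) _ j ≡.refl ≡.refl ⟩
      proj₁ (det-signs n M) (toℕ j) (M zero j *P det n (minor j M))
                                                         ≈⟨ sign-σ n M (toℕ j) _ ⟩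
      sign (toℕ j) *P (M zero j *P det n (minor j M))    ≈⟨ *-congˡ {sign (toℕ j)} (*-congˡ {M zero j} (det≈det n (minor j M))) ⟩
      sign (toℕ j) *P (M zero j *P D.det n (minor j M))  ∎

module Threshold where

  open import Defs using (Poly; prodP; _+P_; _*P_; negP)
  open Polynomials
  open import Data.Nat as ℕ using (ℕ; zero; suc; _≤_; _≤?_)
  import Data.Nat.Properties as ℕ
  open import Data.Integer as ℤ using (ℤ; +_; -_; _+_; _-_; _*_)
  import Data.Integer.Properties as ℤ
  open import Data.Integer.Tactic.RingSolver using (solve-∀)
  open import Data.Fin as Fin using (Fin; zero; suc; punchIn)
  import Data.Fin.Properties as Fin
  open import Data.List using (List; []; _∷_; map; allFin)
  open import Data.List.Relation.Unary.All as All using (All)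
  open import Data.List.Membership.Propositional.Properties using (∈-allFin)
  open import Data.List.Extrema.Nat using (argmax; argmin; f[xs]≤f[argmax]; f[argmin]≤f[xs])
  open import Data.Product using (∃; ∃₂; _×_; _,_)
  open import Function using (_∘_)
  open import Data.Empty using (⊥-elim)
  open import Relation.Binary.PropositionalEquality as ≡ using (_≡_; _≢_)
  open import Relation.Nullary using (Dec; yes; no; ¬_; does)
  open import Data.Bool using (if_then_else_)
  open import Relation.Nullary.Decidable using (¬?; _×-dec_; dec-true; dec-false)
  open import Algebra.Bundles using (CommutativeRing)
  open import Algebra.Properties.Semiring.Sum ℤ.+-*-semiring as ℤΣ using () renaming (sum to sumℤ)

  open CommutativeRing Poly-commutativeRing
    using (_≈_; refl; sym; trans; reflexive; +-cong; +-congˡ; +-congʳ; *-cong; +-assoc; setoid)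
  open Determinant Poly-commutativeRing
  open import Algebra.Properties.Semiring.Sum (CommutativeRing.semiring Poly-commutativeRing) using (sum; sum-remove; sum-cong-≗)
  open import Relation.Binary.Reasoning.Setoid setoid

  constant : ℤ → Poly
  constant z = z ∷ []

  X : Poly
  X = + 0 ∷ + 1 ∷ []

  linearFactor : ℤ → Poly
  linearFactor l = - l ∷ + 1 ∷ []

  Splits : ∀ {n} → Matrix n → Set
  Splits {n} E = ∃ λ (ls : List ℤ) → det n E ≈ prodP (map linearFactor ls)

  X+constant≈linearFactor : ∀ z → X +P constant z ≈ linearFactor (- z)
  X+constant≈linearFactor z = mk≋ λ
    { zero          → ≡.trans (ℤ.+-identityˡ z) (≡.sym (ℤ.neg-involutive z))
    ; (suc zero)    → ≡.refl
    ; (suc (suc k)) → ≡.refl }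

  constant-sum : ∀ {m} (f : Fin m → ℤ) → sum (constant ∘ f) ≈ constant (sumℤ f)
  constant-sum {zero}  f = mk≋ λ { zero → ≡.refl ; (suc k) → ≡.refl }
  constant-sum {suc m} f = +-congˡ {constant (f zero)} (constant-sum (f ∘ suc))

  constant-sub : ∀ a b → constant a +P negP (constant b) ≈ constant (a - b)
  constant-sub a b = reflexive (≡.cong (λ z → (a + z) ∷ []) (-1*b≡-b b))
    where
    -1*b≡-b : ∀ b → - + 1 * b ≡ - b
    -1*b≡-b = solve-∀

  -- Kept abstract: unfolding argmax inside later goals makes type checking explode.
  abstract
    maximum : ∀ {s} (w : Fin (suc s) → ℕ) → ∃ λ m → ∀ q → w q ≤ w m
    maximum {s} w = argmax w zero (allFin (suc s)) , λ q → All.lookup (f[xs]≤f[argmax] {f = w} zero (allFin (suc s))) (∈-allFin q)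

    minimum : ∀ {s} (w : Fin (suc s) → ℕ) → ∃ λ m → ∀ q → w m ≤ w q
    minimum {s} w = argmin w zero (allFin (suc s)) , λ q → All.lookup (f[argmin]≤f[xs] {f = w} zero (allFin (suc s))) (∈-allFin q)

  sumℤ-const-sub : ∀ {m} c (g : Fin m → ℤ) → sumℤ (λ i → c - g i) ≡ c * + m - sumℤ g
  sumℤ-const-sub {zero}  c g = empty c
    where
    empty : ∀ c → + 0 ≡ c * + 0 - + 0
    empty = solve-∀
  sumℤ-const-sub {suc m} c g = ≡.trans (≡.cong (λ S → c - g zero + S) (sumℤ-const-sub c (g ∘ suc))) (step c (g zero) (+ m) (sumℤ (g ∘ suc)))
    where
    step : ∀ c a m S → c - a + (c * m - S) ≡ c * (+ 1 + m) - (a + S)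
    step = solve-∀

  indicator : ∀ {A : Set} → Dec A → ℤ
  indicator (yes _) = + 1
  indicator (no _)  = + 0

  indicator-yes : ∀ {A : Set} (a? : Dec A) → A → indicator a? ≡ + 1
  indicator-yes (yes _) _ = ≡.refl
  indicator-yes (no ¬a) a = ⊥-elim (¬a a)

  indicator-no : ∀ {A : Set} (a? : Dec A) → ¬ A → indicator a? ≡ + 0
  indicator-no (yes a) ¬a = ⊥-elim (¬a a)
  indicator-no (no _)  _  = ≡.refl

  indicator-cong : ∀ {A B : Set} (a? : Dec A) (b? : Dec B) → (A → B) → (B → A) → indicator a? ≡ indicator b?
  indicator-cong (yes a) b? A→B B→A = ≡.sym (indicator-yes b? (A→B a))
  indicator-cong (no ¬a) b? A→B B→A = ≡.sym (indicator-no b? (¬a ∘ B→A))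

  module ThresholdGraph (t : ℕ) where

    Adjacent : ∀ {s} → (Fin s → ℕ) → Fin s → Fin s → Set
    Adjacent w r q = r ≢ q × t ≤ w r ℕ.+ w q

    adjacent? : ∀ {s} (w : Fin s → ℕ) r q → Dec (Adjacent w r q)
    adjacent? w r q = ¬? (r Fin.≟ q) ×-dec (t ≤? w r ℕ.+ w q)

    adjacency : ∀ {s} → (Fin s → ℕ) → Fin s → Fin s → ℤ
    adjacency w r q = indicator (adjacent? w r q)

    degree : ∀ {s} → (Fin s → ℕ) → Fin s → ℤ
    degree w r = sumℤ (adjacency w r)

    adjacency-irrefl : ∀ {s} (w : Fin s → ℕ) r → adjacency w r r ≡ + 0
    adjacency-irrefl w r = indicator-no (adjacent? w r r) λ (r≢r , _) → r≢r ≡.refl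

    adjacency-sym : ∀ {s} (w : Fin s → ℕ) r q → adjacency w r q ≡ adjacency w q r
    adjacency-sym w r q = indicator-cong (adjacent? w r q) (adjacent? w q r) swap swap
      where
      swap : ∀ {r q} → Adjacent w r q → Adjacent w q r
      swap {r} {q} (r≢q , t≤) = r≢q ∘ ≡.sym , ≡.subst (t ≤_) (ℕ.+-comm (w r) (w q)) t≤

    adjacency-punchIn : ∀ {s} (w : Fin (suc s) → ℕ) u r q →
                        adjacency (w ∘ punchIn u) r q ≡ adjacency w (punchIn u r) (punchIn u q)
    adjacency-punchIn w u r q = indicator-cong (adjacent? (w ∘ punchIn u) r q) (adjacent? w (punchIn u r) (punchIn u q))
      (λ (r≢q , t≤) → r≢q ∘ Fin.punchIn-injective u r q , t≤)
      (λ (r≢q , t≤) → r≢q ∘ ≡.cong (punchIn u) , t≤)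

    degree-punchIn : ∀ {s} (w : Fin (suc s) → ℕ) u r →
                     degree w (punchIn u r) ≡ adjacency w u (punchIn u r) + degree (w ∘ punchIn u) r
    degree-punchIn w u r = ≡.trans (ℤΣ.sum-remove (adjacency w (punchIn u r)))
      (≡.cong₂ _+_ (adjacency-sym w (punchIn u r) u) (ℤΣ.sum-cong-≗ λ i → ≡.sym (adjacency-punchIn w u r i)))

    -- A vertex of maximal weight is adjacent to all others, unless a vertex of
    -- minimal weight is adjacent to none.
    dominating-or-isolated : ∀ {s} (w : Fin (suc s) → ℕ) → ∃₂ λ u a → ∀ q → q ≢ u → adjacency w u q ≡ a
    dominating-or-isolated w with maximum w | minimum w
    ... | m , ≤wm | l , wl≤ with t ≤? w m ℕ.+ w l
    ...   | yes t≤ = m , + 1 , λ q q≢m →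
      indicator-yes (adjacent? w m q) (q≢m ∘ ≡.sym , ℕ.≤-trans t≤ (ℕ.+-monoʳ-≤ (w m) (wl≤ q)))
    ...   | no  t≰ = l , + 0 , λ q _ → indicator-no (adjacent? w l q) λ (_ , t≤) →
      t≰ (ℕ.≤-trans t≤ (≡.subst (w l ℕ.+ w q ≤_) (ℕ.+-comm (w l) (w m)) (ℕ.+-monoʳ-≤ (w l) (≤wm q))))

    -- x I + c J + β I + (degree matrix − adjacency matrix), written entrywise.
    thresholdMatrix : ∀ {s} → (Fin s → ℕ) → ℤ → ℤ → Matrix s
    thresholdMatrix w c β r q =
      if does (r Fin.≟ q) then X +P constant (c + β + degree w r) else constant (c - adjacency w r q)

    thresholdMatrix-diag : ∀ {s} (w : Fin s → ℕ) c β r → thresholdMatrix w c β r r ≡ X +P constant (c + β + degree w r)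
    thresholdMatrix-diag w c β r =
      ≡.cong (λ b → if b then X +P constant (c + β + degree w r) else constant (c - adjacency w r r)) (dec-true (r Fin.≟ r) ≡.refl)

    thresholdMatrix-off : ∀ {s} (w : Fin s → ℕ) c β {r q} → r ≢ q → thresholdMatrix w c β r q ≡ constant (c - adjacency w r q)
    thresholdMatrix-off w c β {r} {q} r≢q =
      ≡.cong (λ b → if b then X +P constant (c + β + degree w r) else constant (c - adjacency w r q)) (dec-false (r Fin.≟ q) r≢q)

    thresholdMatrix-row-sum : ∀ {s} (w : Fin (suc s) → ℕ) c β r →
                              sum (thresholdMatrix w c β r) ≈ X +P constant (β + c * + suc s)
    thresholdMatrix-row-sum {s} w c β r = begin
      sum (thresholdMatrix w c β r)
        ≈⟨ sum-remove (thresholdMatrix w c β r) ⟩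
      thresholdMatrix w c β r r +P sum (λ q → thresholdMatrix w c β r (punchIn r q))
        ≈⟨ +-cong (reflexive (thresholdMatrix-diag w c β r))
                  (trans (reflexive (sum-cong-≗ λ q → thresholdMatrix-off w c β (r≢punchIn q)))
                         (constant-sum (λ q → c - adjacency w r (punchIn r q)))) ⟩
      (X +P constant (c + β + degree w r)) +P constant (sumℤ λ q → c - adjacency w r (punchIn r q))
        ≈⟨ +-assoc X (constant (c + β + degree w r)) (constant (sumℤ λ q → c - adjacency w r (punchIn r q))) ⟩
      X +P constant (c + β + degree w r + sumℤ λ q → c - adjacency w r (punchIn r q))
        ≡⟨ ≡.cong (λ z → X +P constant z) arithmetic ⟩
      X +P constant (β + c * + suc s) ∎
      where
      r≢punchIn : ∀ q → r ≢ punchIn r q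
      r≢punchIn q = Fin.punchInᵢ≢i r q ∘ ≡.sym
      others : ℤ
      others = sumℤ λ q → adjacency w r (punchIn r q)
      arithmetic : c + β + degree w r + (sumℤ λ q → c - adjacency w r (punchIn r q)) ≡ β + c * + suc s
      arithmetic = ≡.trans
        (≡.cong₂ (λ d e → c + β + d + e)
           (≡.trans (ℤΣ.sum-remove (adjacency w r)) (≡.cong (λ a → a + others) (adjacency-irrefl w r)))
           (sumℤ-const-sub c _))
        (collect c β others (+ s))
        where
        collect : ∀ c β D m → c + β + (+ 0 + D) + (c * m - D) ≡ β + c * (+ 1 + m)
        collect = solve-∀

    thresholdMatrix-remove : ∀ {s} (w : Fin (suc s) → ℕ) c β u a → (∀ q → q ≢ u → adjacency w u q ≡ a) → ∀ r q →
                             thresholdMatrix w c β (punchIn u r) (punchIn u q) +P negP (thresholdMatrix w c β u (punchIn u q))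
                               ≈ thresholdMatrix (w ∘ punchIn u) a (β + a) r q
    thresholdMatrix-remove {s} w c β u a uniform r q = by-cases (r Fin.≟ q)
      where
      E : Matrix (suc s)
      E = thresholdMatrix w c β
      w′ : Fin s → ℕ
      w′ = w ∘ punchIn u
      row-u : E u (punchIn u q) ≡ constant (c - a)
      row-u = ≡.trans (thresholdMatrix-off w c β (Fin.punchInᵢ≢i u q ∘ ≡.sym))
                      (≡.cong (λ z → constant (c - z)) (uniform (punchIn u q) (Fin.punchInᵢ≢i u q)))

      by-cases : Dec (r ≡ q) → E (punchIn u r) (punchIn u q) +P negP (E u (punchIn u q)) ≈ thresholdMatrix w′ a (β + a) r q
      by-cases (yes ≡.refl) = begin
        E (punchIn u r) (punchIn u r) +P negP (E u (punchIn u r))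
          ≡⟨ ≡.cong₂ (λ x y → x +P negP y) (thresholdMatrix-diag w c β (punchIn u r)) row-u ⟩
        (X +P constant (c + β + degree w (punchIn u r))) +P negP (constant (c - a))
          ≈⟨ +-assoc X (constant (c + β + degree w (punchIn u r))) (negP (constant (c - a))) ⟩
        X +P (constant (c + β + degree w (punchIn u r)) +P negP (constant (c - a)))
          ≈⟨ +-congˡ {X} (constant-sub (c + β + degree w (punchIn u r)) (c - a)) ⟩
        X +P constant (c + β + degree w (punchIn u r) - (c - a))
          ≡⟨ ≡.cong (λ d → X +P constant (c + β + d - (c - a)))
                    (≡.trans (degree-punchIn w u r) (≡.cong (λ z → z + degree w′ r) (uniform (punchIn u r) (Fin.punchInᵢ≢i u r)))) ⟩
        X +P constant (c + β + (a + degree w′ r) - (c - a))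
          ≡⟨ ≡.cong (λ z → X +P constant z) (collect c β a (degree w′ r)) ⟩
        X +P constant (a + (β + a) + degree w′ r)
          ≡⟨ thresholdMatrix-diag w′ a (β + a) r ⟨
        thresholdMatrix w′ a (β + a) r r ∎
        where
        collect : ∀ c β a d → c + β + (a + d) - (c - a) ≡ a + (β + a) + d
        collect = solve-∀
      by-cases (no r≢q) = begin
        E (punchIn u r) (punchIn u q) +P negP (E u (punchIn u q))
          ≡⟨ ≡.cong₂ (λ x y → x +P negP y) (thresholdMatrix-off w c β (r≢q ∘ Fin.punchIn-injective u r q)) row-u ⟩
        constant (c - adjacency w (punchIn u r) (punchIn u q)) +P negP (constant (c - a))
          ≈⟨ constant-sub (c - adjacency w (punchIn u r) (punchIn u q)) (c - a) ⟩
        constant (c - adjacency w (punchIn u r) (punchIn u q) - (c - a))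
          ≡⟨ ≡.cong constant (≡.trans (collect c _ a) (≡.cong (λ z → a - z) (≡.sym (adjacency-punchIn w u r q)))) ⟩
        constant (a - adjacency w′ r q)
          ≡⟨ thresholdMatrix-off w′ a (β + a) r≢q ⟨
        thresholdMatrix w′ a (β + a) r q ∎
        where
        collect : ∀ c x a → c - x - (c - a) ≡ a - x
        collect = solve-∀

    thresholdMatrix-splits : ∀ s (w : Fin s → ℕ) c β → Splits (thresholdMatrix w c β)
    thresholdMatrix-splits zero    w c β = [] , refl
    thresholdMatrix-splits (suc s) w c β with dominating-or-isolated w
    ... | u , a , uniform with thresholdMatrix-splits s (w ∘ punchIn u) a (β + a)
    ...   | ls , det≈∏ = - (β + c * + suc s) ∷ ls , (begin
      det (suc s) E
        ≈⟨ det-constant-row-sums s E u (X +P constant (β + c * + suc s)) (thresholdMatrix-row-sum w c β) ⟩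
      (X +P constant (β + c * + suc s)) *P det s (λ r q → E (punchIn u r) (punchIn u q) +P negP (E u (punchIn u q)))
        ≈⟨ *-cong (X+constant≈linearFactor (β + c * + suc s)) (trans (det-cong s (thresholdMatrix-remove w c β u a uniform)) det≈∏) ⟩
      linearFactor (- (β + c * + suc s)) *P prodP (map linearFactor ls) ∎)
      where
      E : Matrix (suc s)
      E = thresholdMatrix w c β

module ZeroDivisors where

  open import Defs using (Elem; allElems; coef; prodCoef; sumℕ; isZeroᵇ; mulZeroᵇ; isNZZDᵇ)
  open import Data.Nat as ℕ using (ℕ; zero; suc; _+_; _*_; _∸_; _<_; _≤_; _≟_; z≤n; s≤s)
  import Data.Nat.Properties as ℕ
  open import Data.Nat.Divisibility using (_∣_; _∣0; >⇒∤)
  open import Data.Nat.Primality using (Prime; euclidsLemma)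
  open import Data.Bool using (true; false; T; not)
  open import Data.Bool.Properties using (T-∧)
  open import Data.Unit using (tt)
  open import Data.Product using (_×_; _,_)
  open import Function.Bundles using (Equivalence)
  open import Data.Vec using ([]; _∷_)
  open import Data.Fin as Fin using (Fin; toℕ; fromℕ<)
  import Data.Fin.Properties as Fin
  open import Data.List using (List; map; upTo; applyUpTo)
  open import Data.List.Relation.Unary.All.Properties using (all⁺; all⁻)
  open import Data.List.Relation.Unary.All as All using (All)
  open import Data.List.Membership.Propositional using (_∈_; lose; find)
  open import Data.List.Membership.Propositional.Properties using (∈-upTo⁺; ∈-upTo⁻; ∈-allFin; ∈-map⁺; ∈-concatMap⁺)
  open import Data.List.Relation.Unary.Any.Properties using (any⁺; any⁻)
  open import Data.Sum using (_⊎_; inj₁; inj₂; [_,_]′)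
  open import Data.Empty using (⊥-elim)
  open import Function using (_∘_)
  open import Relation.Binary.PropositionalEquality
  open import Relation.Binary.Definitions using (tri<; tri≈; tri>)
  open import Relation.Nullary using (yes; no; ¬_)
  open import Relation.Nullary.Decidable using (toWitness; fromWitness)
  open import Algebra.Properties.Semiring.Sum ℕ.+-*-semiring using (sum; sum-cong-≗; sum-remove; sum-replicate-zero)

  -- The x-adic valuation; it is b on the zero element.
  valuation : ∀ {p b} → Elem p b → ℕ
  valuation []       = 0
  valuation (x ∷ xs) with toℕ x ≟ 0
  ... | yes _ = suc (valuation xs)
  ... | no  _ = 0

  module _ {p : ℕ} where

    valuation-≤ : ∀ {b} (a : Elem p b) → valuation a ≤ b
    valuation-≤ []       = z≤n
    valuation-≤ (x ∷ xs) with toℕ x ≟ 0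
    ... | yes _ = s≤s (valuation-≤ xs)
    ... | no  _ = z≤n

    coef-<valuation : ∀ {b} (a : Elem p b) {k} → k < valuation a → coef a k ≡ 0
    coef-<valuation (x ∷ xs) {k} k<v with toℕ x ≟ 0
    coef-<valuation (x ∷ xs) {zero}  k<v       | yes x≡0 = x≡0
    coef-<valuation (x ∷ xs) {suc k} (s≤s k<v) | yes _   = coef-<valuation xs k<v

    coef-valuation≢0 : ∀ {b} (a : Elem p b) → valuation a < b → coef a (valuation a) ≢ 0
    coef-valuation≢0 (x ∷ xs) v<b with toℕ x ≟ 0
    ... | yes _   = coef-valuation≢0 xs (ℕ.≤-pred v<b)
    ... | no  x≢0 = x≢0

    coef-<p : ∀ {b} (a : Elem p b) {k} → k < b → coef a k < p
    coef-<p (x ∷ xs) {zero}  _         = Fin.toℕ<n x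
    coef-<p (x ∷ xs) {suc k} (s≤s k<b) = coef-<p xs k<b

    coef-≥ : ∀ {b} (a : Elem p b) {k} → b ≤ k → coef a k ≡ 0
    coef-≥ []       _         = refl
    coef-≥ (x ∷ xs) (s≤s b≤k) = coef-≥ xs b≤k

    isZero⇒valuation≮ : ∀ {b} (a : Elem p b) → T (isZeroᵇ a) → ¬ valuation a < b
    isZero⇒valuation≮ {b} a zero? v<b =
      coef-valuation≢0 a v<b (toWitness (All.lookup (all⁺ _ (upTo b) zero?) (∈-upTo⁺ v<b)))

    ¬isZero⇒valuation< : ∀ {b} (a : Elem p b) → ¬ T (isZeroᵇ a) → valuation a < b
    ¬isZero⇒valuation< {b} a nonzero with ℕ.m≤n⇒m<n∨m≡n (valuation-≤ a)
    ... | inj₁ v<b = v<b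
    ... | inj₂ v≡b = ⊥-elim (nonzero (all⁻ _ (All.tabulate λ k∈ →
                       fromWitness (coef-<valuation a (subst (_ <_) (sym v≡b) (∈-upTo⁻ k∈))))))

  sumℕ-applyUpTo : ∀ (g f : ℕ → ℕ) m → sumℕ (map g (applyUpTo f m)) ≡ sum (λ (i : Fin m) → g (f (toℕ i)))
  sumℕ-applyUpTo g f zero    = refl
  sumℕ-applyUpTo g f (suc m) = cong (g (f 0) +_) (sumℕ-applyUpTo g (f ∘ suc) m)

  sum-zero : ∀ {m} {g : Fin m → ℕ} → (∀ i → g i ≡ 0) → sum g ≡ 0
  sum-zero {m} g≡0 = trans (sum-cong-≗ g≡0) (sum-replicate-zero m)

  module _ {p b : ℕ} (a c : Elem p b) where

    private
      term : ℕ → ℕ → ℕ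
      term k i = coef a i * coef c (k ∸ i)

      prodCoef-sum : ∀ k → prodCoef a c k ≡ sum (λ (i : Fin (suc k)) → term k (toℕ i))
      prodCoef-sum k = sumℕ-applyUpTo (term k) (λ i → i) (suc k)

      term≡0 : ∀ k i → i ≤ k → i < valuation a ⊎ k < i + valuation c → term k i ≡ 0
      term≡0 k i i≤k (inj₁ i<va)    = cong (_* coef c (k ∸ i)) (coef-<valuation a i<va)
      term≡0 k i i≤k (inj₂ k<i+vc) = trans (cong (coef a i *_) (coef-<valuation c k∸i<vc)) (ℕ.*-zeroʳ (coef a i))
        where
        k∸i<vc : k ∸ i < valuation c
        k∸i<vc = subst (k ∸ i <_) (ℕ.m+n∸m≡n i (valuation c)) (ℕ.∸-monoˡ-< k<i+vc i≤k)

    prodCoef-< : ∀ k → k < valuation a + valuation c → prodCoef a c k ≡ 0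
    prodCoef-< k k<va+vc = trans (prodCoef-sum k) (sum-zero λ i → term≡0 k (toℕ i) (ℕ.≤-pred (Fin.toℕ<n i)) (vanishing i))
      where
      vanishing : ∀ (i : Fin (suc k)) → toℕ i < valuation a ⊎ k < toℕ i + valuation c
      vanishing i with toℕ i ℕ.<? valuation a
      ... | yes i<va = inj₁ i<va
      ... | no  i≮va = inj₂ (ℕ.<-≤-trans k<va+vc (ℕ.+-monoˡ-≤ (valuation c) (ℕ.≮⇒≥ i≮va)))

    prodCoef-valuation : prodCoef a c (valuation a + valuation c) ≡ coef a (valuation a) * coef c (valuation c)
    prodCoef-valuation = begin
      prodCoef a c k                                      ≡⟨ prodCoef-sum k ⟩
      sum (λ (i : Fin (suc k)) → term k (toℕ i))          ≡⟨ sum-remove {n = k} {i = fromℕ< va<1+k} (λ i → term k (toℕ i)) ⟩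
      term k (toℕ (fromℕ< va<1+k)) + sum (λ i → term k (toℕ (Fin.punchIn (fromℕ< va<1+k) i)))
        ≡⟨ cong₂ _+_ (cong (term k) (Fin.toℕ-fromℕ< va<1+k)) (sum-zero others≡0) ⟩
      term k (valuation a) + 0                            ≡⟨ ℕ.+-identityʳ _ ⟩
      coef a (valuation a) * coef c (k ∸ valuation a)
        ≡⟨ cong (λ j → coef a (valuation a) * coef c j) (ℕ.m+n∸m≡n (valuation a) (valuation c)) ⟩
      coef a (valuation a) * coef c (valuation c)         ∎
      where
      open ≡-Reasoning
      k : ℕ
      k = valuation a + valuation c
      va<1+k : valuation a < suc k
      va<1+k = s≤s (ℕ.m≤m+n (valuation a) (valuation c))
      others≡0 : ∀ i → term k (toℕ (Fin.punchIn (fromℕ< va<1+k) i)) ≡ 0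
      others≡0 i with ℕ.<-cmp (toℕ j) (valuation a)
        where j = Fin.punchIn (fromℕ< va<1+k) i
      ... | tri< j<va _ _ = term≡0 k _ (ℕ.≤-pred (Fin.toℕ<n j)) (inj₁ j<va)
        where j = Fin.punchIn (fromℕ< va<1+k) i
      ... | tri≈ _ j≡va _ = ⊥-elim (Fin.punchInᵢ≢i _ i (Fin.toℕ-injective (trans j≡va (sym (Fin.toℕ-fromℕ< va<1+k)))))
      ... | tri> _ _ va<j = term≡0 k _ (ℕ.≤-pred (Fin.toℕ<n j)) (inj₂ (ℕ.+-monoˡ-< (valuation c) va<j))
        where j = Fin.punchIn (fromℕ< va<1+k) i

  ∤-leading-coef : ∀ {p b} (a : Elem p b) → valuation a < b → ¬ p ∣ coef a (valuation a)
  ∤-leading-coef a v<b = >⇒∤ {{ℕ.≢-nonZero (coef-valuation≢0 a v<b)}} (coef-<p a v<b)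

  module _ {p b : ℕ} (a c : Elem p b) where

    valuation-sum⇒mulZero : b ≤ valuation a + valuation c → T (mulZeroᵇ a c)
    valuation-sum⇒mulZero b≤va+vc = all⁻ _ (All.tabulate λ k∈ →
      fromWitness (subst (p ∣_) (sym (prodCoef-< a c _ (ℕ.<-≤-trans (∈-upTo⁻ k∈) b≤va+vc))) (p ∣0)))

    -- The lowest coefficient of a·c is the product of two units mod p.
    mulZero⇒valuation-sum : Prime p → valuation a < b → valuation c < b → T (mulZeroᵇ a c) → b ≤ valuation a + valuation c
    mulZero⇒valuation-sum p-prime va<b vc<b zero? with b ℕ.≤? valuation a + valuation c
    ... | yes b≤ = b≤
    ... | no  b≰ = ⊥-elim ([ ∤-leading-coef a va<b , ∤-leading-coef c vc<b ]′
                             (euclidsLemma (coef a (valuation a)) (coef c (valuation c)) p-prime p∣leading))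
      where
      p∣leading : p ∣ coef a (valuation a) * coef c (valuation c)
      p∣leading = subst (p ∣_) (prodCoef-valuation a c)
                    (toWitness (All.lookup (all⁺ _ (upTo b) zero?) (∈-upTo⁺ (ℕ.≰⇒> b≰))))

  monomial : ∀ {p} → 1 < p → (m : ℕ) → Elem p (suc m)
  monomial 1<p zero    = fromℕ< 1<p ∷ []
  monomial 1<p (suc m) = fromℕ< (ℕ.<-trans ℕ.z<s 1<p) ∷ monomial 1<p m

  valuation-monomial : ∀ {p} (1<p : 1 < p) m → valuation (monomial 1<p m) ≡ m
  valuation-monomial 1<p zero with toℕ (fromℕ< 1<p) ≟ 0
  ... | yes 1≡0 = ⊥-elim (ℕ.1+n≢0 (trans (sym (Fin.toℕ-fromℕ< 1<p)) 1≡0))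
  ... | no  _   = refl
  valuation-monomial 1<p (suc m) with toℕ (fromℕ< (ℕ.<-trans ℕ.z<s 1<p)) ≟ 0
  ... | yes _   = cong suc (valuation-monomial 1<p m)
  ... | no  0≢0 = ⊥-elim (0≢0 (Fin.toℕ-fromℕ< _))

  ∈-allElems : ∀ {p b} (a : Elem p b) → a ∈ allElems p b
  ∈-allElems []       = here refl
    where open import Data.List.Relation.Unary.Any using (here)
  ∈-allElems {p} {suc b} (x ∷ xs) = ∈-concatMap⁺ _ (lose (∈-allFin x) (∈-map⁺ (x ∷_) (∈-allElems xs)))

  T-not : ∀ {x} → T (not x) → ¬ T x
  T-not {false} _ ()

  not-T : ∀ {x} → ¬ T x → T (not x)
  not-T {false} _   = tt
  not-T {true}  ¬tt = ¬tt tt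

  isNZZD⇒valuation : ∀ {p b} → Prime p → (a : Elem p b) → T (isNZZDᵇ a) → 1 ≤ valuation a × valuation a < b
  isNZZD⇒valuation {p} {b} p-prime a nzzd with Equivalence.to T-∧ nzzd
  ... | a≢0 , ∃c with find (any⁻ _ (allElems p b) ∃c)
  ...   | c , _ , c-witness with Equivalence.to T-∧ c-witness
  ...     | c≢0 , ac≡0 = ℕ.≤∧≢⇒< z≤n va≢0 , va<b
    where
    va<b : valuation a < b
    va<b = ¬isZero⇒valuation< a (T-not a≢0)
    vc<b : valuation c < b
    vc<b = ¬isZero⇒valuation< c (T-not c≢0)
    va≢0 : 0 ≢ valuation a
    va≢0 va≡0 = ℕ.<⇒≱ vc<b (subst (λ v → b ≤ v + valuation c) (sym va≡0) (mulZero⇒valuation-sum a c p-prime va<b vc<b ac≡0))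

  valuation⇒isNZZD : ∀ {p m} → 1 < p → (a : Elem p (suc m)) → 1 ≤ valuation a → valuation a < suc m → T (isNZZDᵇ a)
  valuation⇒isNZZD {p} {m} 1<p a 1≤va va<b = Equivalence.from T-∧
    (not-T (λ zero? → isZero⇒valuation≮ a zero? va<b) , any⁺ _ (lose (∈-allElems xᵐ) (Equivalence.from T-∧ (xᵐ≢0 , axᵐ≡0))))
    where
    xᵐ : Elem p (suc m)
    xᵐ = monomial 1<p m
    xᵐ≢0 : T (not (isZeroᵇ xᵐ))
    xᵐ≢0 = not-T (λ zero? → isZero⇒valuation≮ xᵐ zero? (subst (_< suc m) (sym (valuation-monomial 1<p m)) (ℕ.n<1+n m)))
    axᵐ≡0 : T (mulZeroᵇ a xᵐ)
    axᵐ≡0 = valuation-sum⇒mulZero a xᵐ (subst (λ v → suc m ≤ valuation a + v) (sym (valuation-monomial 1<p m)) (ℕ.+-monoˡ-≤ m 1≤va))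

module DistanceLaplacian where

  open import Defs
  open Polynomials
  open PolynomialDeterminant using (det≈det)
  open Threshold
  module D = Determinant Poly-commutativeRing
  open D using (Matrix; det-cong)
  open import Algebra.Bundles using (CommutativeRing)
  open ZeroDivisors
  open Punch using (distinct⇒2≤)
  open import Data.Nat as ℕ using (ℕ; zero; suc; _+_; _<_; _≤_; z≤n; s≤s)
  import Data.Nat.Properties as ℕ
  open import Data.Nat.Primality using (Prime; prime⇒nonTrivial)
  open import Data.Integer as ℤ using (ℤ; +_; -_)
  import Data.Integer.Properties as ℤ
  open import Data.Integer.Tactic.RingSolver using (solve-∀)
  open import Algebra.Properties.Semiring.Sum ℤ.+-*-semiring as ℤΣ using () renaming (sum to sumℤ)
  open import Data.Bool using (Bool; true; false; T; not; if_then_else_)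
  open import Data.Bool.Properties using (T-∧; T-∨; T-≡)
  import Data.Bool as Bool
  open import Data.Unit using (tt)
  open import Data.Fin as Fin using (Fin; zero; suc)
  import Data.Fin.Properties as Fin
  open import Data.List using (List; []; _∷_; allFin; map; tabulate)
  open import Data.List.Properties using (map-tabulate)
  open import Data.List.Membership.Propositional using (_∈_; lose; find)
  open import Data.List.Membership.Propositional.Properties using (∈-allFin; ∈-lookup; ∈-filter⁺; ∈-filter⁻)
  import Data.List.Relation.Unary.Any as Any
  open import Data.List.Relation.Unary.Any.Properties using (any⁺; any⁻; lookup-index)
  open import Data.Product using (∃; _×_; _,_; proj₁; proj₂)
  open import Data.Sum using (inj₁; inj₂)
  open import Data.Empty using (⊥-elim)
  open import Function using (_∘_)
  open import Function.Bundles using (Equivalence)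
  open import Relation.Binary.PropositionalEquality
  open import Relation.Nullary using (Dec; ¬_; yes; no)
  open import Relation.Unary using (Decidable)
  open import Relation.Nullary.Decidable using (⌊_⌋; toWitness; fromWitness)

  module Distances (n : ℕ) (adj : Fin n → Fin n → Bool) where

    open Graph n adj using (reach; distAux; dist)

    distAux-least : ∀ {i j} fuel k d → d ≤ fuel → (∀ e → e < d → ¬ T (reach (e + k) i j)) → T (reach (d + k) i j) →
                    distAux fuel k i j ≡ d + k
    distAux-least {i} {j} zero       k zero    _         _         _       = refl
    distAux-least {i} {j} (suc fuel) k zero    _         _         reached with reach k i j
    ... | true  = refl
    ... | false = ⊥-elim reached
    distAux-least {i} {j} (suc fuel) k (suc d) (s≤s d≤fuel) unreached reached with reach k i j in eq
    ... | true  = ⊥-elim (unreached 0 ℕ.z<s (subst T (sym eq) tt))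
    ... | false = trans (distAux-least fuel (suc k) d d≤fuel unreached′ (subst (λ l → T (reach l i j)) (sym (ℕ.+-suc d k)) reached))
                        (ℕ.+-suc d k)
      where
      unreached′ : ∀ e → e < d → ¬ T (reach (e + suc k) i j)
      unreached′ e e<d = subst (λ l → ¬ T (reach l i j)) (sym (ℕ.+-suc e k)) (unreached (suc e) (s≤s e<d))

    private
      reach-refl : ∀ i → T (reach 0 i i)
      reach-refl i = fromWitness refl

      reach-≢ : ∀ {i j} → i ≢ j → ¬ T (reach 0 i j)
      reach-≢ i≢j = i≢j ∘ toWitness

      reach-step : ∀ {k i j} w → T (reach k i w) → T (adj w j) → T (reach (suc k) i j)
      reach-step {k} {i} {j} w i⇝w w~j = Equivalence.from T-∨ (inj₂ (any⁺ _ (lose (∈-allFin w) (Equivalence.from T-∧ (i⇝w , w~j)))))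

      reach-1 : ∀ {i j} → i ≢ j → ¬ T (adj i j) → ¬ T (reach 1 i j)
      reach-1 {i} {j} i≢j i≁j i⇝j with Equivalence.to T-∨ i⇝j
      ... | inj₁ i≡j = reach-≢ i≢j i≡j
      ... | inj₂ via with find (any⁻ _ (allFin n) via)
      ...   | w , _ , i⇝w~j with Equivalence.to T-∧ i⇝w~j
      ...     | i≡w , w~j = i≁j (subst (λ v → T (adj v j)) (sym (toWitness {a? = i Fin.≟ w} i≡w)) w~j)

    dist-refl : ∀ i → dist i i ≡ 0
    dist-refl i = distAux-least n 0 0 z≤n (λ _ ()) (reach-refl i)

    dist-adjacent : ∀ {i j} → i ≢ j → T (adj i j) → dist i j ≡ 1
    dist-adjacent {i} {j} i≢j i~j = distAux-least n 0 1 (ℕ.≤-<-trans z≤n (Fin.toℕ<n i))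
      (λ { 0 _ → reach-≢ i≢j ; (suc _) (s≤s ()) })
      (reach-step {0} i (reach-refl i) i~j)

    dist-common-neighbour : ∀ {i j} k → i ≢ j → ¬ T (adj i j) → T (adj i k) → T (adj k j) → dist i j ≡ 2
    dist-common-neighbour {i} {j} k i≢j i≁j i~k k~j = distAux-least n 0 2 (distinct⇒2≤ i≢j)
      (λ { 0 _ → reach-≢ i≢j ; 1 _ → reach-1 i≢j i≁j ; (suc (suc _)) (s≤s (s≤s ())) })
      (reach-step {1} k (reach-step {0} i (reach-refl i) i~k) k~j)

  +sumℕ-allFin : ∀ {n} (d : Fin n → ℕ) → + sumℕ (map d (allFin n)) ≡ sumℤ (λ j → + d j)
  +sumℕ-allFin {n} d = trans (cong (λ l → + sumℕ l) (map-tabulate {n = n} (λ j → j) d)) (go d)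
    where
    go : ∀ {n} (d : Fin n → ℕ) → + sumℕ (tabulate d) ≡ sumℤ (λ j → + d j)
    go {zero}  d = refl
    go {suc n} d = trans (ℤ.pos-+ (d zero) _) (cong (λ z → + d zero ℤ.+ z) (go (d ∘ suc)))

  transmission-diameter≤2 : ∀ {n} (A : Fin n → ℤ) (d : Fin n → ℕ) i → d i ≡ 0 → A i ≡ + 0 →
                            (∀ j → j ≢ i → + d j ≡ + 2 ℤ.- A j) →
                            + sumℕ (map d (allFin n)) ≡ + 2 ℤ.* + n ℤ.- + 2 ℤ.- sumℤ A
  transmission-diameter≤2 {suc n} A d i dᵢ≡0 Aᵢ≡0 d≡2-A = begin
    + sumℕ (map d (allFin (suc n)))                        ≡⟨ +sumℕ-allFin d ⟩
    sumℤ (λ j → + d j)                                      ≡⟨ ℤΣ.sum-remove (λ j → + d j) ⟩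
    + d i ℤ.+ sumℤ (λ j → + d (Fin.punchIn i j))
      ≡⟨ cong₂ ℤ._+_ (cong +_ dᵢ≡0) (ℤΣ.sum-cong-≗ λ j → d≡2-A _ (Fin.punchInᵢ≢i i j)) ⟩
    + 0 ℤ.+ sumℤ (λ j → + 2 ℤ.- A (Fin.punchIn i j))      ≡⟨ cong (λ z → + 0 ℤ.+ z) (sumℤ-const-sub (+ 2) (A ∘ Fin.punchIn i)) ⟩
    + 0 ℤ.+ (+ 2 ℤ.* + n ℤ.- others)                       ≡⟨ collect (+ n) others ⟩
    + 2 ℤ.* (+ 1 ℤ.+ + n) ℤ.- + 2 ℤ.- (+ 0 ℤ.+ others)     ≡⟨ cong (λ a → + 2 ℤ.* + suc n ℤ.- + 2 ℤ.- (a ℤ.+ others)) Aᵢ≡0 ⟨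
    + 2 ℤ.* + suc n ℤ.- + 2 ℤ.- (A i ℤ.+ others)           ≡⟨ cong (λ s → + 2 ℤ.* + suc n ℤ.- + 2 ℤ.- s) (ℤΣ.sum-remove A) ⟨
    + 2 ℤ.* + suc n ℤ.- + 2 ℤ.- sumℤ A                     ∎
    where
    open ≡-Reasoning
    others : ℤ
    others = sumℤ (λ j → A (Fin.punchIn i j))
    collect : ∀ n D → + 0 ℤ.+ (+ 2 ℤ.* n ℤ.- D) ≡ + 2 ℤ.* (+ 1 ℤ.+ n) ℤ.- + 2 ℤ.- (+ 0 ℤ.+ D)
    collect = solve-∀

  module ZeroDivisorGraph (p m : ℕ) (p-prime : Prime p) where

    private
      b : ℕ
      b = suc m

    n : ℕ
    n = nV p b

    weight : Fin n → ℕ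
    weight i = valuation (vertex p b i)

    open ThresholdGraph b
    open Distances n (adjΓ p b)
    open Graph n (adjΓ p b) using (dist)

    private
      1<p : 1 < p
      1<p = ℕ.nonTrivial⇒n>1 p {{prime⇒nonTrivial p-prime}}

      isVertex? : Decidable λ (a : Elem p b) → isNZZDᵇ a ≡ true
      isVertex? a = isNZZDᵇ a Bool.≟ true

    weight-bounds : ∀ i → 1 ≤ weight i × weight i < b
    weight-bounds i = isNZZD⇒valuation p-prime (vertex p b i)
      (Equivalence.from T-≡ (proj₂ (∈-filter⁻ isVertex? {xs = allElems p b} (∈-lookup i))))

    adjΓ⇒Adjacent : ∀ {i j} → T (adjΓ p b i j) → Adjacent weight i j
    adjΓ⇒Adjacent {i} {j} i~j with Equivalence.to (T-∧ {not ⌊ i Fin.≟ j ⌋}) i~j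
    ... | i≢j , ij≡0 = T-not {⌊ i Fin.≟ j ⌋} i≢j ∘ fromWitness ,
          mulZero⇒valuation-sum (vertex p b i) (vertex p b j) p-prime (proj₂ (weight-bounds i)) (proj₂ (weight-bounds j)) ij≡0

    Adjacent⇒adjΓ : ∀ {i j} → Adjacent weight i j → T (adjΓ p b i j)
    Adjacent⇒adjΓ {i} {j} (i≢j , b≤) =
      Equivalence.from (T-∧ {not ⌊ i Fin.≟ j ⌋}) (not-T (i≢j ∘ toWitness) , valuation-sum⇒mulZero (vertex p b i) (vertex p b j) b≤)

    -- x^m, adjacent to every other vertex.
    top-vertex : Fin n → ∃ λ z → weight z ≡ m
    top-vertex i = Any.index xᵐ∈ , trans (cong valuation (sym (lookup-index xᵐ∈))) (valuation-monomial 1<p m)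
      where
      1≤m : 1 ≤ m
      1≤m = ℕ.≤-trans (proj₁ (weight-bounds i)) (ℕ.≤-pred (proj₂ (weight-bounds i)))
      xᵐ∈ : monomial 1<p m ∈ vertexList p b
      xᵐ∈ = ∈-filter⁺ isVertex? (∈-allElems (monomial 1<p m)) (Equivalence.to T-≡
        (valuation⇒isNZZD 1<p (monomial 1<p m) (subst (1 ≤_) (sym (valuation-monomial 1<p m)) 1≤m)
                                (subst (_< b) (sym (valuation-monomial 1<p m)) (ℕ.n<1+n m))))

    dist-weights : ∀ {i j} → i ≢ j → + dist i j ≡ + 2 ℤ.- adjacency weight i j
    dist-weights {i} {j} i≢j with adjacent? weight i j
    ... | yes i~j = cong +_ (dist-adjacent i≢j (Adjacent⇒adjΓ i~j))
    ... | no  i≁j = cong +_ (via (top-vertex i))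
      where
      via : (∃ λ z → weight z ≡ m) → dist i j ≡ 2
      via (z , wz≡m) = dist-common-neighbour z i≢j (i≁j ∘ adjΓ⇒Adjacent) (Adjacent⇒adjΓ i~z) (Adjacent⇒adjΓ z~j)
        where
        b≤w+m : ∀ k → b ≤ weight k + m
        b≤w+m k = ℕ.+-monoˡ-≤ m (proj₁ (weight-bounds k))
        b≤wi+wz : b ≤ weight i + weight z
        b≤wi+wz = subst (λ w → b ≤ weight i + w) (sym wz≡m) (b≤w+m i)
        b≤wz+wj : b ≤ weight z + weight j
        b≤wz+wj = subst (λ w → b ≤ w + weight j) (sym wz≡m) (subst (b ≤_) (ℕ.+-comm (weight j) m) (b≤w+m j))
        i~z : Adjacent weight i z
        i~z = (λ { refl → i≁j (i≢j , b≤wz+wj) }) , b≤wi+wz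
        z~j : Adjacent weight z j
        z~j = (λ { refl → i≁j (i≢j , b≤wi+wz) }) , b≤wz+wj

    -- x I − (Tr − D), whose determinant is Defs.charPoly.
    charMatrix : Matrix n
    charMatrix i j = if ⌊ i Fin.≟ j ⌋ then (- distLapΓ p b i j) ∷ + 1 ∷ [] else (- distLapΓ p b i j) ∷ []

    charMatrix-diag : ∀ i → charMatrix i i ≡ (- (+ Graph.trans n (adjΓ p b) i ℤ.- + dist i i)) ∷ + 1 ∷ []
    charMatrix-diag i = cong (λ d → if ⌊ d ⌋ then entry d ∷ + 1 ∷ [] else entry d ∷ []) (≡-≟-identity Fin._≟_ refl)
      where
      entry : Dec (i ≡ i) → ℤ
      entry d = - (if ⌊ d ⌋ then + Graph.trans n (adjΓ p b) i ℤ.- + dist i i else - (+ dist i i))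

    charMatrix-off : ∀ {i j} → i ≢ j → charMatrix i j ≡ (- - + dist i j) ∷ []
    charMatrix-off {i} {j} i≢j = cong (λ d → if ⌊ d ⌋ then entry d ∷ + 1 ∷ [] else entry d ∷ []) (≢-≟-identity Fin._≟_ i≢j)
      where
      entry : Dec (i ≡ j) → ℤ
      entry d = - (if ⌊ d ⌋ then + Graph.trans n (adjΓ p b) i ℤ.- + dist i j else - (+ dist i j))

    -- c = 2 and β = −2n: for diameter two, x I − (Tr − D) = x I + 2J − 2n I + (Deg − A).
    E : Matrix n
    E = thresholdMatrix weight (+ 2) (- (+ 2 ℤ.* + n))

    charMatrix≈E : ∀ i j → charMatrix i j ≋ E i j
    charMatrix≈E i j = by-cases (i Fin.≟ j)
      where
      by-cases : Dec (i ≡ j) → charMatrix i j ≋ E i j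
      by-cases (yes refl) = mk≋ λ k → trans (cong (λ e → coeffP e k) (charMatrix-diag i))
        (trans (diagonal k) (cong (λ e → coeffP e k) (sym (thresholdMatrix-diag weight (+ 2) (- (+ 2 ℤ.* + n)) i))))
        where
        open ≡-Reasoning
        transmission : + Graph.trans n (adjΓ p b) i ≡ + 2 ℤ.* + n ℤ.- + 2 ℤ.- degree weight i
        transmission = transmission-diameter≤2 (adjacency weight i) (dist i) i (dist-refl i) (adjacency-irrefl weight i)
                         (λ j j≢i → dist-weights (j≢i ∘ sym))
        collect : ∀ n D → - (+ 2 ℤ.* n ℤ.- + 2 ℤ.- D ℤ.- + 0) ≡ + 0 ℤ.+ (+ 2 ℤ.+ - (+ 2 ℤ.* n) ℤ.+ D)
        collect = solve-∀
        diagonal : ((- (+ Graph.trans n (adjΓ p b) i ℤ.- + dist i i)) ∷ + 1 ∷ [])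
                   ≈P (X +P constant (+ 2 ℤ.+ - (+ 2 ℤ.* + n) ℤ.+ degree weight i))
        diagonal zero = begin
          - (+ Graph.trans n (adjΓ p b) i ℤ.- + dist i i)
            ≡⟨ cong (λ d → - (+ Graph.trans n (adjΓ p b) i ℤ.- + d)) (dist-refl i) ⟩
          - (+ Graph.trans n (adjΓ p b) i ℤ.- + 0)                 ≡⟨ cong (λ t → - (t ℤ.- + 0)) transmission ⟩
          - (+ 2 ℤ.* + n ℤ.- + 2 ℤ.- degree weight i ℤ.- + 0)      ≡⟨ collect (+ n) (degree weight i) ⟩
          + 0 ℤ.+ (+ 2 ℤ.+ - (+ 2 ℤ.* + n) ℤ.+ degree weight i)    ∎
        diagonal (suc zero)    = refl
        diagonal (suc (suc k)) = refl
      by-cases (no i≢j) = mk≋ λ k → trans (cong (λ e → coeffP e k) (charMatrix-off i≢j))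
        (trans (off-diagonal k) (cong (λ e → coeffP e k) (sym (thresholdMatrix-off weight (+ 2) (- (+ 2 ℤ.* + n)) i≢j))))
        where
        off-diagonal : ((- - + dist i j) ∷ []) ≈P constant (+ 2 ℤ.- adjacency weight i j)
        off-diagonal zero    = trans (ℤ.neg-involutive (+ dist i j)) (dist-weights i≢j)
        off-diagonal (suc k) = refl

    distanceLaplacian-integral : DistanceLaplacianIntegral p b
    distanceLaplacian-integral = ls , get {charPoly n (distLapΓ p b)} {prodP (map linearFactor ls)} (begin
      det n charMatrix                                             ≈⟨ det≈det n charMatrix ⟩
      D.det n charMatrix                                           ≈⟨ det-cong n charMatrix≈E ⟩
      D.det n E                                                    ≈⟨ proj₂ splits ⟩
      prodP (map linearFactor ls)                                  ∎)
      where
      open import Relation.Binary.Reasoning.Setoid (CommutativeRing.setoid Poly-commutativeRing)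
      splits : Splits E
      splits = thresholdMatrix-splits n weight (+ 2) (- (+ 2 ℤ.* + n))
      ls : List ℤ
      ls = proj₁ splits

corollary4p2 : (p b : ℕ) → Prime p → b ≥ 1 → DistanceLaplacianIntegral p b
corollary4p2 p (suc m) p-prime (s≤s z≤n) = DistanceLaplacian.ZeroDivisorGraph.distanceLaplacian-integral p m p-prime
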